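{- Let $r<s\le N/2$ be positive integers. Starting from the Gale–Robinson quiver with principal coefficients $\widehat Q_N^{(r,s)}$ and initial cluster $\{x_1,\dots,x_N,y_1,\dots,y_N\}$, mutate periodically at $1,2,\dots,N,1,2,\dots$, and set $x_n$ ($n\ge N+1$) to be the new cluster variable created by the $(n-N)$-th mutation. Then for all $n\ge N+1$, $$x_nx_{n-N}=x_{n-r}x_{n-N+r}+\prod_{i=1}^N y_i^{\,d(n-N-i,\,r,\,N-r)}\;x_{n-s}x_{n-N+s}.$$
   Context: Gale–Robinson quiver $Q_N^{(r,s)}$ on vertices $1,\dots,N$: (1) arrows $i\to i+r$ for $1\le i\le N-r$ and $j\to N-r+j$ for $1\le j\le r$; (2) arrows $s+i\to i$ for $1\le i\le N-s$ and $N-s+j\to j$ for $1\le j\le s$; (3) arrows $r+i\to s+i$ for $1\le i\le N-r-s$ and $r+j\to N-s+j$ for $1\le j\le s-r$; (4) erase all 2-cycles. $\widehat Q_N^{(r,s)}$ adds frozen (never mutated) vertices $N+1,\dots,2N$ carrying variables $y_1,\dots,y_N$ and one arrow $N+i\to i$ for each $i$. Mutation at $k$: quiver mutation (add $i\to j$ for each path $i\to k\to j$, reverse arrows at $k$, remove 2-cycles), and the variable $X_k$ is replaced by $\big(\prod_{i\to k}X_i+\prod_{k\to j}X_j\big)/X_k$, products over arrows (with multiplicity, including those with frozen vertices). Periodic mutation: the $m$-th mutation is at vertex $((m-1)\bmod N)+1$. For integers $m,a,b$, $d(m,a,b)$ is the number of pairs of nonnegative integers $(A,B)$ with $m=Aa+Bb$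 (zero if none). -}

module Defs where

open import Level using (Level; _⊔_) renaming (suc to lsuc)
open import Data.Nat using (ℕ; zero; suc; _+_; _*_; _∸_; _%_; _≟_; _≤?_)
open import Data.Integer using (ℤ; +_; -[1+_])
open import Data.Bool using (Bool; true; false; if_then_else_; _∨_; _∧_)
open import Data.List using (List; map; upTo)
open import Data.Nat.ListAction using (sum)
open import Data.Product using (_×_; _,_; proj₁; proj₂)
open import Relation.Nullary using (does)
open import Relation.Binary.Core using (Rel)
open import Algebra.Core using (Op₁; Op₂)
open import Algebra.Structures using (IsCommutativeSemigroup; IsAbelianGroup)
open import Algebra.Definitions using (_DistributesOver_)

-- Semifields: (+) commutative semigroup, (*) abelian group, (*)
-- distributes over (+).  The exchange relations are subtraction-free,
-- so cluster variables make sense in every semifield.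

record Semifield (c ℓ : Level) : Set (lsuc (c ⊔ ℓ)) where
  infixl 7 _⊗_
  infixl 6 _⊕_
  infix  4 _≈_
  field
    Carrier : Set c
    _≈_     : Rel Carrier ℓ
    _⊕_     : Op₂ Carrier
    _⊗_     : Op₂ Carrier
    1#      : Carrier
    _⁻¹     : Op₁ Carrier
    +-isCommutativeSemigroup : IsCommutativeSemigroup _≈_ _⊕_
    *-isAbelianGroup         : IsAbelianGroup _≈_ _⊗_ 1# _⁻¹
    distrib                  : _DistributesOver_ _≈_ _⊗_ _⊕_

  infixr 8 _^_
  _^_ : Carrier → ℕ → Carrier
  a ^ zero  = 1#
  a ^ suc n = a ⊗ (a ^ n)

  prodFrom : ℕ → ℕ → (ℕ → Carrier) → Carrier
  prodFrom lo zero      f = 1#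
  prodFrom lo (suc len) f = f lo ⊗ prodFrom (suc lo) len f

  prod1 : ℕ → (ℕ → Carrier) → Carrier
  prod1 M f = prodFrom 1 M f

eqb : ℕ → ℕ → Bool
eqb m n = does (m ≟ n)

ind : Bool → ℕ
ind true  = 1
ind false = 0

count1 : ℕ → (ℕ → Bool) → ℕ
count1 M P = sum (map (λ t → ind (P (suc t))) (upTo M))

-- d(m,a,b) = #{(A,B) ∈ ℕ² | m = A a + B b}  (0 if m < 0).
-- For a, b ≥ 1 every solution has A, B ≤ m, so the search is exhaustive.

dℕ : ℕ → ℕ → ℕ → ℕ
dℕ m a b = sum (map (λ A → sum (map (λ B → ind (eqb (A * a + B * b) m))
                                     (upTo (suc m))))
                     (upTo (suc m)))

d : ℤ → ℕ → ℕ → ℕ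
d (+ m)      a b = dℕ m a b
d -[1+ m ]   a b = 0

-- Quivers on vertices 1..2N as arrow-multiplicity functions
-- Q u v = number of arrows u → v.

Quiver : Set
Quiver = ℕ → ℕ → ℕ

family : ℕ → (ℕ → ℕ) → (ℕ → ℕ) → Quiver
family M src tgt u v = count1 M (λ t → eqb (src t) u ∧ eqb (tgt t) v)

-- steps (1)–(3) with multiplicity, before erasing 2-cycles
GRraw : ℕ → ℕ → ℕ → Quiver
GRraw N r s u v =
    family (N ∸ r)     (λ i → i)         (λ i → i + r)     u v
  + family r           (λ j → j)         (λ j → N ∸ r + j) u v
  + family (N ∸ s)     (λ i → s + i)     (λ i → i)         u v
  + family s           (λ j → N ∸ s + j) (λ j → j)         u v
  + family (N ∸ r ∸ s) (λ i → r + i)     (λ i → s + i)     u v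
  + family (s ∸ r)     (λ j → r + j)     (λ j → N ∸ s + j) u v

eraseTwoCycles : Quiver → Quiver
eraseTwoCycles Q u v = Q u v ∸ Q v u

GR : ℕ → ℕ → ℕ → Quiver
GR N r s = eraseTwoCycles (GRraw N r s)

GRhat : ℕ → ℕ → ℕ → Quiver
GRhat N r s u v = GR N r s u v + family N (λ i → N + i) (λ i → i) u v

mutQuiver : ℕ → Quiver → Quiver
mutQuiver k Q = eraseTwoCycles C
  where
  C : Quiver
  C u v = if eqb u k ∨ eqb v k then Q v u else Q u v + Q u k * Q k v

mutVertex : ℕ → ℕ → ℕ
mutVertex zero    m = 0
mutVertex (suc n) m = suc ((m ∸ 1) % suc n)

module GaleRobinson {c ℓ} (F : Semifield c ℓ) (N r s : ℕ)
                    (x y : ℕ → Semifield.Carrier F) where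
  open Semifield F

  Vars : Set c
  Vars = ℕ → Carrier

  mutVars : ℕ → Quiver → Vars → Vars
  mutVars k Q X v =
    if eqb v k
    then (prod1 (N + N) (λ u → X u ^ Q u k) ⊕ prod1 (N + N) (λ w → X w ^ Q k w))
           ⊗ (X k ⁻¹)
    else X v

  initVars : Vars
  initVars v = if does (v ≤? N) then x v else y (v ∸ N)

  seed : ℕ → Quiver × Vars
  seed zero    = GRhat N r s , initVars
  seed (suc m) = let k = mutVertex N (suc m) ; Q = proj₁ (seed m) ; X = proj₂ (seed m)
                 in mutQuiver k Q , mutVars k Q X

  xs : ℕ → Carrier
  xs n = if does (n ≤? N) then x n
         else proj₂ (seed (n ∸ N)) (mutVertex N (n ∸ N))

-- Relabel the mutable vertices after each mutation by σ (1 ↦ N, w + 1 ↦ w), so that every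
-- mutation takes place at the label 1. In these labels the mutable part of the exchange matrix never
-- changes: Q_N^{(r,s)} is a union of six diagonals {(a + t, b + t)}, so shifting both indices by
-- one changes it only by terms at the ends of the diagonals, and these are exactly the arrows that
-- mutation at 1 creates, together with the reversal of the arrows at 1. After m mutations the
-- frozen vertex N + i has F v (m + v − i) arrows to the label v, where F is built from
-- D = d(·, r, N − r); that this survives mutation at 1 is a first-order recurrence in v whose one
-- nontrivial step (v = N − r) is the identity D z − D (z − r) = [z = 0] + D (z − N + r) − D (z − N),
-- obtained by splitting off the representations with A = 0 and then those with B = 0. Reading off
-- the arrows at label 1 gives the exchange relation: in from the labels s + 1, N − s + 1 and from
-- N + i with multiplicity d(m + 1 − i, r, N − r), out to the labels r + 1 and N − r + 1.

module Submission where

open import Data.Nat.Base using (ℕ; NonZero)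
open import Defs

module Counting where

  open import Data.Nat
  open import Data.Nat.Properties
  open import Data.Bool using (true; false; _∧_)
  open import Data.List using (map; applyUpTo)
  open import Data.Nat.ListAction using (sum)
  open import Function using (_∘_; id)
  open import Relation.Binary.PropositionalEquality
  open import Relation.Nullary.Decidable using (dec-false)

  sum< : ℕ → (ℕ → ℕ) → ℕ
  sum< zero    f = 0
  sum< (suc n) f = f 0 + sum< n (f ∘ suc)

  syntax sum< n (λ i → e) = ∑[ i < n ] e

  sum-map-applyUpTo : ∀ n (f g : ℕ → ℕ) → sum (map f (applyUpTo g n)) ≡ sum< n (f ∘ g)
  sum-map-applyUpTo zero    f g = refl
  sum-map-applyUpTo (suc n) f g = cong (f (g 0) +_) (sum-map-applyUpTo n f (g ∘ suc))

  sum<-cong : ∀ n {f g : ℕ → ℕ} → (∀ i → i < n → f i ≡ g i) → sum< n f ≡ sum< n g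
  sum<-cong zero    eq = refl
  sum<-cong (suc n) eq = cong₂ _+_ (eq 0 z<s) (sum<-cong n (λ i i<n → eq (suc i) (s<s i<n)))

  sum<-zero : ∀ n (f : ℕ → ℕ) → (∀ i → i < n → f i ≡ 0) → sum< n f ≡ 0
  sum<-zero n f f≡0 = trans (sum<-cong n f≡0) (zeros n)
    where
    zeros : ∀ n → sum< n (λ _ → 0) ≡ 0
    zeros zero    = refl
    zeros (suc n) = zeros n

  sum<-suc : ∀ n (f : ℕ → ℕ) → sum< (suc n) f ≡ sum< n f + f n
  sum<-suc zero    f = +-comm (f 0) 0
  sum<-suc (suc n) f = trans (cong (f 0 +_) (sum<-suc n (f ∘ suc))) (sym (+-assoc (f 0) _ _))

  sum<-+ : ∀ K n (f : ℕ → ℕ) → (∀ i → K ≤ i → f i ≡ 0) → sum< (K + n) f ≡ sum< K f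
  sum<-+ K zero    f f≡0 = cong (λ L → sum< L f) (+-identityʳ K)
  sum<-+ K (suc n) f f≡0 = begin
    sum< (K + suc n) f         ≡⟨ cong (λ L → sum< L f) (+-suc K n) ⟩
    sum< (suc (K + n)) f       ≡⟨ sum<-suc (K + n) f ⟩
    sum< (K + n) f + f (K + n) ≡⟨ cong₂ _+_ (sum<-+ K n f f≡0) (f≡0 (K + n) (m≤m+n K n)) ⟩
    sum< K f + 0               ≡⟨ +-identityʳ _ ⟩
    sum< K f                   ∎
    where open ≡-Reasoning

  sum<-extend : ∀ K L (f : ℕ → ℕ) → K ≤ L → (∀ i → K ≤ i → f i ≡ 0) → sum< L f ≡ sum< K f
  sum<-extend K L f K≤L f≡0 = trans (cong (λ n → sum< n f) (sym (m+[n∸m]≡n K≤L))) (sum<-+ K (L ∸ K) f f≡0)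

  eqb-refl : ∀ n → eqb n n ≡ true
  eqb-refl zero    = refl
  eqb-refl (suc n) = eqb-refl n

  eqb-≢ : ∀ {m n} → m ≢ n → eqb m n ≡ false
  eqb-≢ {m} {n} = dec-false (m ≟ n)

  δ : ℕ → ℕ → ℕ
  δ m n = ind (eqb m n)

  δ-refl : ∀ n → δ n n ≡ 1
  δ-refl n = cong ind (eqb-refl n)

  δ-≢ : ∀ {m n} → m ≢ n → δ m n ≡ 0
  δ-≢ m≢n = cong ind (eqb-≢ m≢n)

  δ-> : ∀ {m n} → n < m → δ m n ≡ 0
  δ-> n<m = δ-≢ (>⇒≢ n<m)

  δ-sym : ∀ m n → δ m n ≡ δ n m
  δ-sym zero    zero    = refl
  δ-sym zero    (suc n) = refl
  δ-sym (suc m) zero    = refl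
  δ-sym (suc m) (suc n) = δ-sym m n

  δ-+ : ∀ a m n → δ (a + m) (a + n) ≡ δ m n
  δ-+ zero    m n = refl
  δ-+ (suc a) m n = δ-+ a m n

  ind-∧ : ∀ b c → ind (b ∧ c) ≡ ind b * ind c
  ind-∧ true  c = sym (+-identityʳ (ind c))
  ind-∧ false c = refl

  sum<-δ : ∀ n t (h : ℕ → ℕ) → t < n → ∑[ i < n ] (δ t i * h i) ≡ h t
  sum<-δ (suc n) zero    h _ = begin
    1 * h 0 + ∑[ i < n ] (δ 0 (suc i) * h (suc i)) ≡⟨ cong (1 * h 0 +_) (sum<-zero n _ (λ _ _ → refl)) ⟩
    1 * h 0 + 0                                   ≡⟨ trans (+-identityʳ _) (*-identityˡ _) ⟩
    h 0                                           ∎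
    where open ≡-Reasoning
  sum<-δ (suc n) (suc t) h (s<s t<n) = sum<-δ n t (h ∘ suc) t<n

  δ-0-∸ : ∀ {i v} → i ≤ v → δ 0 (v ∸ i) ≡ δ v i
  δ-0-∸ {v = v} z≤n     = δ-sym 0 v
  δ-0-∸ (s≤s i≤v)       = δ-0-∸ i≤v

  count1-sum< : ∀ M P → count1 M P ≡ ∑[ t < M ] ind (P (suc t))
  count1-sum< M P = sum-map-applyUpTo M (λ t → ind (P (suc t))) id

  dℕ-sum< : ∀ m a b → dℕ m a b ≡ ∑[ A < suc m ] ∑[ B < suc m ] δ (A * a + B * b) m
  dℕ-sum< m a b = trans (sum-map-applyUpTo (suc m) _ id)
    (sum<-cong (suc m) (λ A _ → sum-map-applyUpTo (suc m) (λ B → δ (A * a + B * b) m) id))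

module IntegerFacts where

  open import Data.Nat as ℕ using (ℕ; zero; suc; _∸_)
  import Data.Nat.Properties as ℕ
  open import Data.Integer using (ℤ; +_; -[1+_]; _+_; _-_; -_)
  open import Data.Integer.Properties
  open import Data.Sum using (_⊎_; inj₁; inj₂)
  open import Data.Product using (∃; _,_)
  open import Relation.Binary.PropositionalEquality
  open Counting using (δ)

  [_]₊ : ℤ → ℕ
  [ + n      ]₊ = n
  [ -[1+ n ] ]₊ = 0

  δ₀ : ℤ → ℤ
  δ₀ (+ zero)    = + 1
  δ₀ (+ suc _)   = + 0
  δ₀ -[1+ _ ]    = + 0

  δ₀-+ : ∀ m → δ₀ (+ m) ≡ + δ 0 m
  δ₀-+ zero    = refl
  δ₀-+ (suc m) = refl

  +-∸-≥ : ∀ {m n} → n ℕ.≤ m → + m - + n ≡ + (m ∸ n)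
  +-∸-≥ {m} {n} n≤m = trans (m-n≡m⊖n m n) (⊖-≥ n≤m)

  +-∸-< : ∀ {m n} → m ℕ.< n → ∃ λ q → + m - + n ≡ -[1+ q ]
  +-∸-< {m} {n} m<n with n ∸ m | ℕ.m<n⇒0<n∸m m<n | trans (m-n≡m⊖n m n) (⊖-< m<n)
  ... | suc q | _ | eq = q , eq

  ∸≡[-]₊ : ∀ m n → m ∸ n ≡ [ + m - + n ]₊
  ∸≡[-]₊ m n with ℕ.≤-<-connex n m
  ... | inj₁ n≤m = cong [_]₊ (sym (+-∸-≥ n≤m))
  ... | inj₂ m<n with +-∸-< m<n
  ...   | q , eq = trans (ℕ.m≤n⇒m∸n≡0 (ℕ.<⇒≤ m<n)) (cong [_]₊ (sym eq))

  -[1+]-+ : ∀ m c → -[1+ m ] - + c ≡ -[1+ m ℕ.+ c ]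
  -[1+]-+ m zero    = cong -[1+_] (sym (ℕ.+-identityʳ m))
  -[1+]-+ m (suc c) = cong -[1+_] (sym (ℕ.+-suc m c))

  [-+]₊ : ∀ n → [ - + n ]₊ ≡ 0
  [-+]₊ zero    = refl
  [-+]₊ (suc n) = refl

  [h]₊-[-h]₊ : ∀ h → + [ h ]₊ - + [ - h ]₊ ≡ h
  [h]₊-[-h]₊ (+ zero)  = refl
  [h]₊-[-h]₊ (+ suc n) = cong (λ k → + suc k) (ℕ.+-identityʳ n)
  [h]₊-[-h]₊ -[1+ n ]  = refl

  [+-+]₊-disjoint : ∀ m n → m ≡ 0 ⊎ n ≡ 0 → [ + m - + n ]₊ ≡ m
  [+-+]₊-disjoint .0 zero    (inj₁ refl) = refl
  [+-+]₊-disjoint .0 (suc n) (inj₁ refl) = refl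
  [+-+]₊-disjoint m  .0      (inj₂ refl) = cong [_]₊ (+-identityʳ (+ m))

module RepresentationCount (a b : ℕ) .{{_ : NonZero a}} .{{_ : NonZero b}} where

  open import Data.Nat
  open import Data.Nat.Properties
  open import Data.Integer as ℤ using (ℤ; +_; -[1+_])
  import Data.Integer.Properties as ℤ
  open import Data.Integer.Tactic.RingSolver using (solve-∀)
  open import Data.Sum using (inj₁; inj₂)
  open import Data.Product using (_,_)
  open import Relation.Binary.PropositionalEquality
  open Counting
  open IntegerFacts

  private
    a>0 : 0 < a
    a>0 = >-nonZero⁻¹ a
    b>0 : 0 < b
    b>0 = >-nonZero⁻¹ b

  multiples : ℕ → ℕ
  multiples m = ∑[ B < suc m ] δ (B * b) m

  private
    truncate-B : ∀ c L m → m < L → ∑[ B < L ] δ (c + B * b) m ≡ ∑[ B < suc m ] δ (c + B * b) m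
    truncate-B c L m m<L = sum<-extend (suc m) L _ m<L
      (λ B m<B → δ-> (≤-trans m<B (≤-trans (m≤m*n B b) (m≤n+m (B * b) c))))

    dℕ-bounds : ∀ L₁ L₂ m → m < L₁ → m < L₂ →
                ∑[ A < L₁ ] ∑[ B < L₂ ] δ (A * a + B * b) m ≡ dℕ m a b
    dℕ-bounds L₁ L₂ m m<L₁ m<L₂ = begin
      ∑[ A < L₁ ] ∑[ B < L₂ ] δ (A * a + B * b) m
        ≡⟨ sum<-cong L₁ (λ A _ → truncate-B (A * a) L₂ m m<L₂) ⟩
      ∑[ A < L₁ ] ∑[ B < suc m ] δ (A * a + B * b) m
        ≡⟨ sum<-extend (suc m) L₁ _ m<L₁ (λ A m<A → sum<-zero (suc m) _
             (λ B _ → δ-> (≤-trans m<A (≤-trans (m≤m*n A a) (m≤m+n (A * a) (B * b)))))) ⟩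
      ∑[ A < suc m ] ∑[ B < suc m ] δ (A * a + B * b) m
        ≡⟨ sym (dℕ-sum< m a b) ⟩
      dℕ m a b ∎
      where open ≡-Reasoning

  -- Split off the representations with A = 0; the others are those of m − a, shifted.
  dℕ-+a : ∀ m → dℕ (a + m) a b ≡ multiples (a + m) + dℕ m a b
  dℕ-+a m = trans (dℕ-sum< (a + m) a b) (cong (λ k → multiples (a + m) + k) (begin
    ∑[ A < a + m ] ∑[ B < suc (a + m) ] δ (a + A * a + B * b) (a + m)
      ≡⟨ sum<-cong (a + m) (λ A _ → sum<-cong (suc (a + m)) (λ B _ →
           trans (cong (λ c → δ c (a + m)) (+-assoc a (A * a) (B * b))) (δ-+ a _ m))) ⟩
    ∑[ A < a + m ] ∑[ B < suc (a + m) ] δ (A * a + B * b) m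
      ≡⟨ dℕ-bounds (a + m) (suc (a + m)) m (m<n+m m a>0) (s≤s (m≤n+m m a)) ⟩
    dℕ m a b ∎))
    where open ≡-Reasoning

  dℕ-<a : ∀ m → m < a → dℕ m a b ≡ multiples m
  dℕ-<a m m<a = trans (dℕ-sum< m a b) (trans (cong (λ k → multiples m + k)
    (sum<-zero m _ (λ A _ → sum<-zero (suc m) _ (λ B _ →
      δ-> (≤-trans m<a (≤-trans (m≤m+n a (A * a)) (m≤m+n (a + A * a) (B * b))))))))
    (+-identityʳ _))

  multiples-+b : ∀ m → multiples (b + m) ≡ δ 0 (b + m) + multiples m
  multiples-+b m = cong (λ k → δ 0 (b + m) + k) (begin
    ∑[ B < b + m ] δ (b + B * b) (b + m) ≡⟨ sum<-cong (b + m) (λ B _ → δ-+ b (B * b) m) ⟩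
    ∑[ B < b + m ] δ (0 + B * b) m       ≡⟨ truncate-B 0 (b + m) m (m<n+m m b>0) ⟩
    multiples m                          ∎)
    where open ≡-Reasoning

  multiples-<b : ∀ m → m < b → multiples m ≡ δ 0 m
  multiples-<b m m<b = trans (cong (λ k → δ 0 m + k)
    (sum<-zero m _ (λ B _ → δ-> (≤-trans m<b (m≤m+n b (B * b)))))) (+-identityʳ _)

  private
    dℕ-≥a : ∀ m → a ≤ m → dℕ m a b ≡ multiples m + dℕ (m ∸ a) a b
    dℕ-≥a m a≤m with m ∸ a | m+[n∸m]≡n a≤m
    ... | k | refl = dℕ-+a k

    multiples-≥b : ∀ m → b ≤ m → multiples m ≡ δ 0 m + multiples (m ∸ b)
    multiples-≥b m b≤m with m ∸ b | m+[n∸m]≡n b≤m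
    ... | k | refl = multiples-+b k

    x+y-y≡x : ∀ x y → (x ℤ.+ y) ℤ.- y ≡ x
    x+y-y≡x = solve-∀

  D : ℤ → ℕ
  D z = d z a b

  M : ℤ → ℕ
  M (+ m)    = multiples m
  M -[1+ _ ] = 0

  D-difference : ∀ z → + D z ℤ.- + D (z ℤ.- + a) ≡ + M z
  D-difference -[1+ m ] rewrite -[1+]-+ m a = refl
  D-difference (+ m) with ≤-<-connex a m
  ... | inj₁ a≤m rewrite +-∸-≥ a≤m | dℕ-≥a m a≤m | ℤ.pos-+ (multiples m) (dℕ (m ∸ a) a b) =
    x+y-y≡x (+ multiples m) (+ dℕ (m ∸ a) a b)
  ... | inj₂ m<a with +-∸-< m<a
  ...   | _ , eq rewrite eq | dℕ-<a m m<a = ℤ.+-identityʳ (+ multiples m)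

  M-step : ∀ z → + M z ≡ δ₀ z ℤ.+ + M (z ℤ.- + b)
  M-step -[1+ m ] rewrite -[1+]-+ m b = refl
  M-step (+ m) with ≤-<-connex b m
  ... | inj₁ b≤m rewrite +-∸-≥ b≤m | multiples-≥b m b≤m | δ₀-+ m = ℤ.pos-+ (δ 0 m) (multiples (m ∸ b))
  ... | inj₂ m<b with +-∸-< m<b
  ...   | _ , eq rewrite eq | multiples-<b m m<b | δ₀-+ m = sym (ℤ.+-identityʳ (+ δ 0 m))

  D-second-difference : ∀ z → + D z ℤ.- + D (z ℤ.- + a)
                            ≡ δ₀ z ℤ.+ (+ D (z ℤ.- + b) ℤ.- + D (z ℤ.- + b ℤ.- + a))
  D-second-difference z = begin
    + D z ℤ.- + D (z ℤ.- + a)                        ≡⟨ D-difference z ⟩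
    + M z                                            ≡⟨ M-step z ⟩
    δ₀ z ℤ.+ + M (z ℤ.- + b)                         ≡⟨ cong (λ w → δ₀ z ℤ.+ w) (sym (D-difference (z ℤ.- + b))) ⟩
    δ₀ z ℤ.+ (+ D (z ℤ.- + b) ℤ.- + D (z ℤ.- + b ℤ.- + a)) ∎
    where open ≡-Reasoning

  D-small : ∀ m → m < a → m < b → D (+ m) ≡ δ 0 m
  D-small m m<a m<b = trans (dℕ-<a m m<a) (multiples-<b m m<b)

  D-difference-small : ∀ m → m < b → + D (+ m) ℤ.- + D (+ m ℤ.- + a) ≡ + δ 0 m
  D-difference-small m m<b = trans (D-difference (+ m)) (cong +_ (multiples-<b m m<b))

module Diagonals where

  open import Data.Nat
  open import Data.Bool using (_∧_)
  open import Data.Nat.Properties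
  open import Relation.Binary.PropositionalEquality
  open Counting

  diagonal : ℕ → ℕ → ℕ → ℕ → ℕ → ℕ
  diagonal a b M u v = ∑[ t < M ] (δ (a + suc t) u * δ (b + suc t) v)

  family≡diagonal : ∀ M src tgt a b u v →
                    (∀ t → src (suc t) ≡ a + suc t) → (∀ t → tgt (suc t) ≡ b + suc t) →
                    family M src tgt u v ≡ diagonal a b M u v
  family≡diagonal M src tgt a b u v src≡ tgt≡ =
    trans (count1-sum< M (λ t → eqb (src t) u ∧ eqb (tgt t) v)) (sum<-cong M (λ t _ →
      trans (ind-∧ (eqb (src (suc t)) u) (eqb (tgt (suc t)) v))
            (cong₂ (λ i j → δ i u * δ j v) (src≡ t) (tgt≡ t))))

  diagonal-translate : ∀ a b M u v →
    diagonal a b M u v + δ (a + 1) (suc u) * δ (b + 1) (suc v)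
    ≡ diagonal a b M (suc u) (suc v) + δ (a + suc M) (suc u) * δ (b + suc M) (suc v)
  diagonal-translate a b M u v = begin
    diagonal a b M u v + g 0       ≡⟨ +-comm (diagonal a b M u v) (g 0) ⟩
    g 0 + diagonal a b M u v       ≡⟨ cong (g 0 +_) (sum<-cong M (λ t _ →
                                        sym (cong₂ (λ i j → δ i (suc u) * δ j (suc v)) (+-suc a (suc t)) (+-suc b (suc t))))) ⟩
    sum< (suc M) g                 ≡⟨ sum<-suc M g ⟩
    sum< M g + g M                 ∎
    where
    open ≡-Reasoning
    g : ℕ → ℕ
    g t = δ (a + suc t) (suc u) * δ (b + suc t) (suc v)

  m+[1+n∸m]≡1+n : ∀ {m n} → m ≤ n → m + suc (n ∸ m) ≡ suc n
  m+[1+n∸m]≡1+n {m} m≤n = trans (+-suc m _) (cong suc (m+[n∸m]≡n m≤n))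

  [n∸m]+[1+m]≡1+n : ∀ {m n} → m ≤ n → n ∸ m + suc m ≡ suc n
  [n∸m]+[1+m]≡1+n {m} {n} m≤n = trans (+-suc (n ∸ m) m) (cong suc (m∸n+n≡m m≤n))

  data Outside (N u v : ℕ) : Set where
    src-zero   : u ≡ 0 → Outside N u v
    tgt-zero   : v ≡ 0 → Outside N u v
    src-beyond : N < u → Outside N u v
    tgt-beyond : N < v → Outside N u v

  Outside-swap : ∀ {N u v} → Outside N u v → Outside N v u
  Outside-swap (src-zero e)   = tgt-zero e
  Outside-swap (tgt-zero e)   = src-zero e
  Outside-swap (src-beyond e) = tgt-beyond e
  Outside-swap (tgt-beyond e) = src-beyond e

  diagonal-outside : ∀ {N} a b M {u v} → a + M ≤ N → b + M ≤ N → Outside N u v → diagonal a b M u v ≡ 0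
  diagonal-outside {N} a b M {u} {v} a+M≤N b+M≤N out = sum<-zero M _ (λ t t<M → vanishes t t<M out)
    where
    within : ∀ c t → t < M → c + M ≤ N → c + suc t ≤ N
    within c t t<M c+M≤N = ≤-trans (+-monoʳ-≤ c t<M) c+M≤N

    positive : ∀ c t → c + suc t ≢ 0
    positive c t eq = 1+n≢0 (trans (sym (+-suc c t)) eq)

    vanishes : ∀ t → t < M → Outside N u v → δ (a + suc t) u * δ (b + suc t) v ≡ 0
    vanishes t t<M (src-zero refl) = cong (_* δ (b + suc t) v) (δ-≢ (positive a t))
    vanishes t t<M (tgt-zero refl) = trans (cong (δ (a + suc t) u *_) (δ-≢ (positive b t))) (*-zeroʳ (δ (a + suc t) u))
    vanishes t t<M (src-beyond N<u) =
      cong (_* δ (b + suc t) v) (δ-≢ (λ eq → <⇒≱ N<u (subst (_≤ N) eq (within a t t<M a+M≤N))))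
    vanishes t t<M (tgt-beyond N<v) = trans (cong (δ (a + suc t) u *_)
      (δ-≢ (λ eq → <⇒≱ N<v (subst (_≤ N) eq (within b t t<M b+M≤N))))) (*-zeroʳ (δ (a + suc t) u))

module DiagonalDifferences where

  open import Data.Nat as ℕ using (ℕ; suc)
  import Data.Nat.Properties as ℕ
  open import Data.Integer using (ℤ; +_; 0ℤ; _+_; _-_; _*_)
  import Data.Integer.Properties as ℤ
  open import Data.Integer.Tactic.RingSolver using (solve-∀)
  open import Relation.Binary.PropositionalEquality
  open Counting
  open Diagonals

  ι : ℕ → ℕ → ℤ
  ι c u = + δ c u

  ι-≢ : ∀ {c u} → c ≢ u → ι c u ≡ 0ℤ
  ι-≢ c≢u = cong +_ (δ-≢ c≢u)

  Δ : (ℕ → ℕ → ℕ) → ℕ → ℕ → ℤ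
  Δ f u v = + f u v - + f v u

  Δ-diagonal-translate : ∀ a b M u v {p q p′ q′} →
    a ℕ.+ 1 ≡ p → b ℕ.+ 1 ≡ q → a ℕ.+ suc M ≡ p′ → b ℕ.+ suc M ≡ q′ →
    Δ (diagonal a b M) u v
      ≡ Δ (diagonal a b M) (suc u) (suc v)
        + (ι p′ (suc u) * ι q′ (suc v) - ι p (suc u) * ι q (suc v))
        - (ι p′ (suc v) * ι q′ (suc u) - ι p (suc v) * ι q (suc u))
  Δ-diagonal-translate a b M u v refl refl refl refl =
    trans (cong₂ _-_ (translate u v) (translate v u))
          (regroup (+ diagonal a b M (suc u) (suc v)) (end u v) (start u v)
                   (+ diagonal a b M (suc v) (suc u)) (end v u) (start v u))
    where
    start end : ℕ → ℕ → ℤ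
    start u v = ι (a ℕ.+ 1) (suc u) * ι (b ℕ.+ 1) (suc v)
    end   u v = ι (a ℕ.+ suc M) (suc u) * ι (b ℕ.+ suc M) (suc v)

    translate : ∀ u v → + diagonal a b M u v ≡ + diagonal a b M (suc u) (suc v) + end u v - start u v
    translate u v = begin
      + x                               ≡⟨ sym (cancel (+ x) (+ e)) ⟩
      + x + + e - + e                   ≡⟨ cong (_- + e) (sym (ℤ.pos-+ x e)) ⟩
      + (x ℕ.+ e) - + e                 ≡⟨ cong (λ n → + n - + e) (diagonal-translate a b M u v) ⟩
      + (y ℕ.+ e′) - + e                ≡⟨ cong (_- + e) (ℤ.pos-+ y e′) ⟩
      + y + + e′ - + e                  ≡⟨ cong₂ (λ i j → + y + i - j) (ℤ.pos-* (δ (a ℕ.+ suc M) (suc u)) _)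
                                                                        (ℤ.pos-* (δ (a ℕ.+ 1) (suc u)) _) ⟩
      + y + end u v - start u v         ∎
      where
      open ≡-Reasoning
      x = diagonal a b M u v
      y = diagonal a b M (suc u) (suc v)
      e = δ (a ℕ.+ 1) (suc u) ℕ.* δ (b ℕ.+ 1) (suc v)
      e′ = δ (a ℕ.+ suc M) (suc u) ℕ.* δ (b ℕ.+ suc M) (suc v)
      cancel : ∀ x e → x + e - e ≡ x
      cancel = solve-∀
    regroup : ∀ x e f y e′ f′ → (x + e - f) - (y + e′ - f′) ≡ (x - y) + (e - f) - (e′ - f′)
    regroup = solve-∀

  ι-above : ∀ {c u} → u ℕ.< c → ι c u ≡ 0ℤ
  ι-above u<c = cong +_ (δ-> u<c)

  ι-below : ∀ {c u} → c ℕ.< u → ι c u ≡ 0ℤ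
  ι-below c<u = ι-≢ (ℕ.<⇒≢ c<u)

module MatrixMutation where

  open import Data.Nat as ℕ using (ℕ)
  import Data.Nat.Properties as ℕ
  open import Data.Integer using (ℤ; +_; -[1+_]; _+_; _-_; _*_; -_)
  import Data.Integer.Properties as ℤ
  open import Data.Integer.Tactic.RingSolver using (solve-∀)
  open import Data.Bool using (true; false; if_then_else_; _∨_)
  open import Data.Bool.Properties using (∨-comm; ∨-zeroʳ)
  open import Relation.Binary.PropositionalEquality
  open Counting using (eqb-refl; eqb-≢)
  open IntegerFacts

  μ : ℕ → (ℕ → ℕ → ℤ) → ℕ → ℕ → ℤ
  μ k B u v = if eqb u k ∨ eqb v k then - B u v
              else B u v + + [ B u k ]₊ * + [ B k v ]₊ - + [ B v k ]₊ * + [ B k u ]₊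

  mutQuiver-[]₊ : ∀ (B : ℕ → ℕ → ℤ) → (∀ u v → B v u ≡ - B u v) →
                  ∀ k u v → mutQuiver k (λ a b → [ B a b ]₊) u v ≡ [ μ k B u v ]₊
  mutQuiver-[]₊ B skew k u v rewrite ∨-comm (eqb v k) (eqb u k) with eqb u k ∨ eqb v k
  ... | true  rewrite skew u v = [-h]₊∸[h]₊ (B u v)
    where
    [-h]₊∸[h]₊ : ∀ h → [ - h ]₊ ℕ.∸ [ h ]₊ ≡ [ - h ]₊
    [-h]₊∸[h]₊ (+ ℕ.zero)  = refl
    [-h]₊∸[h]₊ (+ ℕ.suc _) = refl
    [-h]₊∸[h]₊ -[1+ _ ]    = refl
  ... | false rewrite skew u v = begin
    ([ h ]₊ ℕ.+ x ℕ.* y) ℕ.∸ ([ - h ]₊ ℕ.+ x′ ℕ.* y′)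
      ≡⟨ ∸≡[-]₊ ([ h ]₊ ℕ.+ x ℕ.* y) ([ - h ]₊ ℕ.+ x′ ℕ.* y′) ⟩
    [ + ([ h ]₊ ℕ.+ x ℕ.* y) - + ([ - h ]₊ ℕ.+ x′ ℕ.* y′) ]₊
      ≡⟨ cong [_]₊ (cong₂ _-_ (trans (ℤ.pos-+ [ h ]₊ (x ℕ.* y)) (cong (λ p → + [ h ]₊ + p) (ℤ.pos-* x y)))
                               (trans (ℤ.pos-+ [ - h ]₊ (x′ ℕ.* y′)) (cong (λ p → + [ - h ]₊ + p) (ℤ.pos-* x′ y′)))) ⟩
    [ (+ [ h ]₊ + + x * + y) - (+ [ - h ]₊ + + x′ * + y′) ]₊
      ≡⟨ cong [_]₊ (trans (regroup (+ [ h ]₊) (+ [ - h ]₊) (+ x * + y) (+ x′ * + y′))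
                          (cong (λ g → g + + x * + y - + x′ * + y′) ([h]₊-[-h]₊ h))) ⟩
    [ h + + x * + y - + x′ * + y′ ]₊ ∎
    where
    open ≡-Reasoning
    h  = B u v
    x  = [ B u k ]₊
    y  = [ B k v ]₊
    x′ = [ B v k ]₊
    y′ = [ B k u ]₊
    regroup : ∀ a b c d → (a + c) - (b + d) ≡ (a - b) + c - d
    regroup = solve-∀

  μ-src : ∀ k B v → μ k B k v ≡ - B k v
  μ-src k B v rewrite eqb-refl k = refl

  μ-tgt : ∀ k B u → μ k B u k ≡ - B u k
  μ-tgt k B u rewrite eqb-refl k | ∨-zeroʳ (eqb u k) = refl

  μ-away : ∀ k B {u v} → u ≢ k → v ≢ k →
           μ k B u v ≡ B u v + + [ B u k ]₊ * + [ B k v ]₊ - + [ B v k ]₊ * + [ B k u ]₊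
  μ-away k B u≢k v≢k rewrite eqb-≢ u≢k | eqb-≢ v≢k = refl

  mutQuiver-cong : ∀ k {Q Q′ : Quiver} → (∀ a b → Q a b ≡ Q′ a b) → ∀ u v → mutQuiver k Q u v ≡ mutQuiver k Q′ u v
  mutQuiver-cong k Q≡Q′ u v
    rewrite Q≡Q′ u v | Q≡Q′ v u | Q≡Q′ u k | Q≡Q′ k v | Q≡Q′ v k | Q≡Q′ k u = refl

  mutQuiver-relabel : ∀ (f : ℕ → ℕ) → (∀ a b → eqb (f a) (f b) ≡ eqb a b) →
                      ∀ k (Q : Quiver) u v → mutQuiver k (λ a b → Q (f a) (f b)) u v ≡ mutQuiver (f k) Q (f u) (f v)
  mutQuiver-relabel f f-eqb k Q u v rewrite f-eqb u k | f-eqb v k = refl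

module Rotation (N : ℕ) .{{_ : NonZero N}} where

  open import Data.Nat
  open import Data.Nat.Properties
  open import Data.Nat.DivMod using (_%_; m%n<n; m<n⇒m%n≡m; n%n≡0; %-distribˡ-+; m%n%n≡m%n)
  open import Data.Bool using (if_then_else_)
  open import Data.Product using (∃; _×_; _,_; proj₁; proj₂)
  open import Data.Sum using (inj₁; inj₂)
  open import Relation.Nullary using (does; yes; no; contradiction)
  open import Relation.Nullary.Decidable using (dec-true; dec-false)
  open import Relation.Binary.PropositionalEquality
  open Counting using (eqb-refl; eqb-≢)

  private
    N>0 : 0 < N
    N>0 = >-nonZero⁻¹ N

  data Position : ℕ → Set where
    at-0     : Position 0
    at-1     : Position 1
    interior : ∀ w → 1 ≤ w → w < N → Position (suc w)
    beyond   : ∀ {u} → N < u → Position u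

  position : ∀ u → Position u
  position zero          = at-0
  position (suc zero)    = at-1
  position (suc (suc w)) with suc (suc w) ≤? N
  ... | yes 2+w≤N = interior (suc w) (s≤s z≤n) 2+w≤N
  ... | no  2+w≰N = beyond (≰⇒> 2+w≰N)

  -- Mutating Q_N^{(r,s)} at 1 gives Q_N^{(r,s)} again, relabelled by σ.
  σ : ℕ → ℕ
  σ zero          = zero
  σ (suc zero)    = N
  σ (suc (suc w)) = if does (suc (suc w) ≤? N) then suc w else suc (suc w)

  σ-interior : ∀ {w} → 1 ≤ w → w < N → σ (suc w) ≡ w
  σ-interior {suc w} _ 2+w≤N rewrite dec-true (suc (suc w) ≤? N) 2+w≤N = refl

  σ-beyond : ∀ {u} → N < u → σ u ≡ u
  σ-beyond {suc zero}    (s≤s N≤0) = contradiction N≤0 (<⇒≱ N>0)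
  σ-beyond {suc (suc w)} N<2+w rewrite dec-false (suc (suc w) ≤? N) (<⇒≱ N<2+w) = refl

  σ-range : ∀ {u} → 1 ≤ u → u ≤ N → 1 ≤ σ u × σ u ≤ N
  σ-range {u} 1≤u u≤N with position u
  ... | at-0                = contradiction 1≤u λ ()
  ... | at-1                = N>0 , ≤-refl
  ... | interior w 1≤w w<N  rewrite σ-interior 1≤w w<N = 1≤w , <⇒≤ w<N
  ... | beyond N<u          = contradiction u≤N (<⇒≱ N<u)

  σ-≤N : ∀ {u} → u ≤ N → σ u ≤ N
  σ-≤N {u} u≤N with position u
  ... | at-0               = z≤n
  ... | at-1               = ≤-refl
  ... | interior w 1≤w w<N rewrite σ-interior 1≤w w<N = <⇒≤ w<N
  ... | beyond N<u         = contradiction u≤N (<⇒≱ N<u)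

  ρ : ℕ → ℕ
  ρ zero    = zero
  ρ (suc w) = if does (suc w <? N) then suc (suc w) else if eqb (suc w) N then 1 else suc w

  ρ-interior : ∀ {c} → 1 ≤ c → c < N → ρ c ≡ suc c
  ρ-interior {suc w} _ c<N rewrite dec-true (suc w <? N) c<N = refl

  ρ-N : ρ N ≡ 1
  ρ-N = top N refl
    where
    top : ∀ c → c ≡ N → ρ c ≡ 1
    top zero    0≡N = contradiction (sym 0≡N) (>⇒≢ N>0)
    top (suc w) c≡N rewrite dec-false (suc w <? N) (λ c<N → <-irrefl c≡N c<N) | c≡N | eqb-refl N = refl

  ρ-beyond : ∀ {u} → N < u → ρ u ≡ u
  ρ-beyond {suc w} N<u
    rewrite dec-false (suc w <? N) (<-asym N<u) | eqb-≢ {suc w} {N} (>⇒≢ N<u) = refl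

  ρ-σ : ∀ u → ρ (σ u) ≡ u
  ρ-σ u with position u
  ... | at-0               = refl
  ... | at-1               = ρ-N
  ... | interior w 1≤w w<N rewrite σ-interior 1≤w w<N = ρ-interior 1≤w w<N
  ... | beyond N<u         rewrite σ-beyond N<u = ρ-beyond N<u

  σ-ρ : ∀ {c} → 1 ≤ c → c ≤ N → σ (ρ c) ≡ c
  σ-ρ {c} 1≤c c≤N with m≤n⇒m<n∨m≡n c≤N
  ... | inj₁ c<N  rewrite ρ-interior 1≤c c<N = σ-interior 1≤c c<N
  ... | inj₂ refl rewrite ρ-N = refl

  ρ-range : ∀ {c} → 1 ≤ c → c ≤ N → 1 ≤ ρ c × ρ c ≤ N
  ρ-range {c} 1≤c c≤N with m≤n⇒m<n∨m≡n c≤N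
  ... | inj₁ c<N  rewrite ρ-interior 1≤c c<N = s≤s z≤n , c<N
  ... | inj₂ refl rewrite ρ-N = ≤-refl , N>0

  -- τ m u is the label, after m mutations, of the vertex labelled u initially.
  τ : ℕ → ℕ → ℕ
  τ zero    u = u
  τ (suc m) u = σ (τ m u)

  τ-injective : ∀ m {u v} → τ m u ≡ τ m v → u ≡ v
  τ-injective zero    eq = eq
  τ-injective (suc m) {u} {v} eq = τ-injective m (trans (sym (ρ-σ (τ m u))) (trans (cong ρ eq) (ρ-σ (τ m v))))

  τ-eqb : ∀ m a b → eqb (τ m a) (τ m b) ≡ eqb a b
  τ-eqb m a b with a ≟ b
  ... | yes refl = trans (eqb-refl (τ m a)) (sym (eqb-refl a))
  ... | no  a≢b  = trans (eqb-≢ (λ e → a≢b (τ-injective m e))) (sym (eqb-≢ a≢b))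

  τ-σ : ∀ m u → τ m (σ u) ≡ σ (τ m u)
  τ-σ zero    u = refl
  τ-σ (suc m) u = cong σ (τ-σ m u)

  τ-beyond : ∀ m {u} → N < u → τ m u ≡ u
  τ-beyond zero    N<u = refl
  τ-beyond (suc m) N<u = trans (cong σ (τ-beyond m N<u)) (σ-beyond N<u)

  τ-≤N : ∀ m {u} → u ≤ N → τ m u ≤ N
  τ-≤N zero    u≤N = u≤N
  τ-≤N (suc m) u≤N = σ-≤N (τ-≤N m u≤N)

  τ-range : ∀ m {u} → 1 ≤ u → u ≤ N → 1 ≤ τ m u × τ m u ≤ N
  τ-range zero    1≤u u≤N = 1≤u , u≤N
  τ-range (suc m) 1≤u u≤N = σ-range (proj₁ (τ-range m 1≤u u≤N)) (proj₂ (τ-range m 1≤u u≤N))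

  τ-surjective : ∀ m {c} → 1 ≤ c → c ≤ N → ∃ λ w → (1 ≤ w × w ≤ N) × τ m w ≡ c
  τ-surjective zero    {c} 1≤c c≤N = c , (1≤c , c≤N) , refl
  τ-surjective (suc m) {c} 1≤c c≤N with τ-surjective m (proj₁ (ρ-range 1≤c c≤N)) (proj₂ (ρ-range 1≤c c≤N))
  ... | w , w∈ , τw≡ρc = w , w∈ , trans (cong σ τw≡ρc) (σ-ρ 1≤c c≤N)

  κ : ℕ → ℕ
  κ m = mutVertex N (suc m)

  κ≡ : ∀ m → κ m ≡ suc (m % N)
  κ≡ m = mutVertex-suc N m
    where
    mutVertex-suc : ∀ M .{{_ : NonZero M}} m → mutVertex M (suc m) ≡ suc (m % M)
    mutVertex-suc (suc M) m = refl

  κ-range : ∀ m → 1 ≤ κ m × κ m ≤ N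
  κ-range m rewrite κ≡ m = s≤s z≤n , m%n<n m N

  private
    suc-% : ∀ m → suc m % N ≡ suc (m % N) % N
    suc-% m = begin
      suc m % N                 ≡⟨ cong (_% N) (+-comm 1 m) ⟩
      (m + 1) % N               ≡⟨ %-distribˡ-+ m 1 N ⟩
      (m % N + 1 % N) % N       ≡⟨ cong (λ x → (x + 1 % N) % N) (sym (m%n%n≡m%n m N)) ⟩
      (m % N % N + 1 % N) % N   ≡⟨ sym (%-distribˡ-+ (m % N) 1 N) ⟩
      (m % N + 1) % N           ≡⟨ cong (_% N) (+-comm (m % N) 1) ⟩
      suc (m % N) % N           ∎
      where open ≡-Reasoning

  κ-suc : ∀ m → κ (suc m) ≡ ρ (κ m)
  κ-suc m rewrite κ≡ (suc m) | κ≡ m | suc-% m with suc (m % N) <? N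
  ... | yes 1+m%N<N = trans (cong suc (m<n⇒m%n≡m 1+m%N<N)) (sym (ρ-interior (s≤s z≤n) 1+m%N<N))
  ... | no  1+m%N≮N = trans (cong suc (trans (cong (_% N) 1+m%N≡N) (n%n≡0 N))) (sym (trans (cong ρ 1+m%N≡N) ρ-N))
    where
    1+m%N≡N : suc (m % N) ≡ N
    1+m%N≡N = ≤∧≮⇒≡ (m%n<n m N) 1+m%N≮N

  τ-κ : ∀ m → τ m (κ m) ≡ 1
  τ-κ zero    rewrite κ≡ 0 = cong suc (m<n⇒m%n≡m N>0)
  τ-κ (suc m) = begin
    σ (τ m (κ (suc m)))   ≡⟨ cong (λ c → σ (τ m c)) (κ-suc m) ⟩
    σ (τ m (ρ (κ m)))     ≡⟨ sym (τ-σ m (ρ (κ m))) ⟩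
    τ m (σ (ρ (κ m)))     ≡⟨ cong (τ m) (σ-ρ (proj₁ (κ-range m)) (proj₂ (κ-range m))) ⟩
    τ m (κ m)             ≡⟨ τ-κ m ⟩
    1                     ∎
    where open ≡-Reasoning

module Products {c ℓ} (F : Semifield c ℓ) where

  open import Data.Nat as ℕ using (ℕ; zero; suc; z≤n; s≤s)
  import Data.Nat.Properties as ℕ
  open import Algebra.Bundles using (AbelianGroup)
  import Algebra.Properties.CommutativeSemigroup as CommutativeSemigroupProperties
  import Relation.Binary.PropositionalEquality as ≡
  open import Relation.Binary.PropositionalEquality using (_≡_)
  open import Relation.Nullary using (yes; no; contradiction)
  open Semifield F
  open Counting using (δ; δ-refl; δ-≢)

  *-abelianGroup : AbelianGroup c ℓ
  *-abelianGroup = record { isAbelianGroup = *-isAbelianGroup }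

  open AbelianGroup *-abelianGroup public
    using (setoid; refl; sym; trans; ∙-cong; assoc; comm; identityˡ; identityʳ; inverseˡ)
  open CommutativeSemigroupProperties (AbelianGroup.commutativeSemigroup *-abelianGroup) using (interchange)
  open import Relation.Binary.Reasoning.Setoid setoid

  ≡⇒≈ : ∀ {a b} → a ≡ b → a ≈ b
  ≡⇒≈ ≡.refl = refl

  ^-+ : ∀ a m n → a ^ (m ℕ.+ n) ≈ a ^ m ⊗ a ^ n
  ^-+ a zero    n = sym (identityˡ _)
  ^-+ a (suc m) n = begin
    a ⊗ a ^ (m ℕ.+ n)     ≈⟨ ∙-cong refl (^-+ a m n) ⟩
    a ⊗ (a ^ m ⊗ a ^ n)   ≈⟨ sym (assoc _ _ _) ⟩
    a ⊗ a ^ m ⊗ a ^ n     ∎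

  prodFrom-cong : ∀ lo len {f g : ℕ → Carrier} →
                  (∀ i → lo ℕ.≤ i → i ℕ.< lo ℕ.+ len → f i ≈ g i) → prodFrom lo len f ≈ prodFrom lo len g
  prodFrom-cong lo zero      f≈g = refl
  prodFrom-cong lo (suc len) f≈g = ∙-cong (f≈g lo ℕ.≤-refl (ℕ.m<m+n lo (s≤s z≤n)))
    (prodFrom-cong (suc lo) len (λ i lo<i i<end → f≈g i (ℕ.<⇒≤ lo<i) (ℕ.≤-trans i<end (ℕ.≤-reflexive (≡.sym (ℕ.+-suc lo len))))))

  prodFrom-⊗ : ∀ lo len (f g : ℕ → Carrier) →
               prodFrom lo len (λ i → f i ⊗ g i) ≈ prodFrom lo len f ⊗ prodFrom lo len g
  prodFrom-⊗ lo zero      f g = sym (identityˡ _)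
  prodFrom-⊗ lo (suc len) f g = trans (∙-cong refl (prodFrom-⊗ (suc lo) len f g)) (interchange _ _ _ _)

  prodFrom-1 : ∀ lo len (f : ℕ → Carrier) → (∀ i → lo ℕ.≤ i → i ℕ.< lo ℕ.+ len → f i ≈ 1#) → prodFrom lo len f ≈ 1#
  prodFrom-1 lo len f f≈1 = trans (prodFrom-cong lo len f≈1) (ones lo len)
    where
    ones : ∀ lo len → prodFrom lo len (λ _ → 1#) ≈ 1#
    ones lo zero      = refl
    ones lo (suc len) = trans (identityˡ _) (ones (suc lo) len)

  prodFrom-+ : ∀ lo a b (f : ℕ → Carrier) → prodFrom lo (a ℕ.+ b) f ≈ prodFrom lo a f ⊗ prodFrom (lo ℕ.+ a) b f
  prodFrom-+ lo zero    b f = trans (≡⇒≈ (≡.cong (λ l → prodFrom l b f) (≡.sym (ℕ.+-identityʳ lo)))) (sym (identityˡ _))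
  prodFrom-+ lo (suc a) b f = begin
    f lo ⊗ prodFrom (suc lo) (a ℕ.+ b) f                          ≈⟨ ∙-cong refl (prodFrom-+ (suc lo) a b f) ⟩
    f lo ⊗ (prodFrom (suc lo) a f ⊗ prodFrom (suc lo ℕ.+ a) b f)  ≈⟨ sym (assoc _ _ _) ⟩
    f lo ⊗ prodFrom (suc lo) a f ⊗ prodFrom (suc lo ℕ.+ a) b f    ≈⟨ ≡⇒≈ (≡.cong (λ l → f lo ⊗ prodFrom (suc lo) a f ⊗ prodFrom l b f) (≡.sym (ℕ.+-suc lo a))) ⟩
    f lo ⊗ prodFrom (suc lo) a f ⊗ prodFrom (lo ℕ.+ suc a) b f    ∎

  prodFrom-shift : ∀ M lo len (f : ℕ → Carrier) → prodFrom (M ℕ.+ lo) len f ≡ prodFrom lo len (λ i → f (M ℕ.+ i))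
  prodFrom-shift M lo zero      f = ≡.refl
  prodFrom-shift M lo (suc len) f = ≡.cong (f (M ℕ.+ lo) ⊗_)
    (≡.trans (≡.cong (λ l → prodFrom l len f) (≡.sym (ℕ.+-suc M lo))) (prodFrom-shift M (suc lo) len f))

  prodFrom-δ : ∀ lo len (f : ℕ → Carrier) {w} → lo ℕ.≤ w → w ℕ.< lo ℕ.+ len →
               prodFrom lo len (λ u → f u ^ δ w u) ≈ f w
  prodFrom-δ lo zero      f lo≤w w<lo+0 = contradiction (ℕ.≤-trans w<lo+0 (ℕ.≤-reflexive (ℕ.+-identityʳ lo))) (ℕ.≤⇒≯ lo≤w)
  prodFrom-δ lo (suc len) f {w} lo≤w w<end with w ℕ.≟ lo
  ... | yes ≡.refl = begin
    f w ^ δ w w ⊗ prodFrom (suc w) len (λ u → f u ^ δ w u)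
      ≈⟨ ∙-cong (≡⇒≈ (≡.cong (f w ^_) (δ-refl w)))
                (prodFrom-1 (suc w) len _ (λ u w<u _ → ≡⇒≈ (≡.cong (f u ^_) (δ-≢ (ℕ.<⇒≢ w<u))))) ⟩
    f w ⊗ 1# ⊗ 1#   ≈⟨ trans (identityʳ _) (identityʳ _) ⟩
    f w             ∎
  ... | no w≢lo = begin
    f lo ^ δ w lo ⊗ prodFrom (suc lo) len (λ u → f u ^ δ w u)
      ≈⟨ ∙-cong (≡⇒≈ (≡.cong (f lo ^_) (δ-≢ w≢lo)))
                (prodFrom-δ (suc lo) len f (ℕ.≤∧≢⇒< lo≤w (λ e → w≢lo (≡.sym e))) (ℕ.≤-trans w<end (ℕ.≤-reflexive (ℕ.+-suc lo len)))) ⟩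
    1# ⊗ f w   ≈⟨ identityˡ _ ⟩
    f w        ∎

  cancel-⁻¹ : ∀ a b c → b ≈ c → a ⊗ b ⁻¹ ⊗ c ≈ a
  cancel-⁻¹ a b c b≈c = begin
    a ⊗ b ⁻¹ ⊗ c     ≈⟨ assoc _ _ _ ⟩
    a ⊗ (b ⁻¹ ⊗ c)   ≈⟨ ∙-cong refl (∙-cong refl (sym b≈c)) ⟩
    a ⊗ (b ⁻¹ ⊗ b)   ≈⟨ ∙-cong refl (inverseˡ b) ⟩
    a ⊗ 1#           ≈⟨ identityʳ a ⟩
    a                ∎

module Parameters where

  open import Data.Nat using (_<_; _≤_; _*_)

  record Admissible (N r s : ℕ) : Set where
    field
      r>0  : 0 < r
      r<s  : r < s
      2s≤N : 2 * s ≤ N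

open Parameters using (Admissible)

module Arithmetic {N r s : ℕ} (adm : Admissible N r s) where

  open import Data.Nat
  open import Data.Nat.Properties
  open import Data.Nat.Tactic.RingSolver using (solve-∀)
  open import Relation.Binary.PropositionalEquality
  open Admissible adm public

  r≤s : r ≤ s
  r≤s = <⇒≤ r<s

  s>0 : 0 < s
  s>0 = <-trans r>0 r<s

  s+s≤N : s + s ≤ N
  s+s≤N = subst (_≤ N) (cong (s +_) (+-identityʳ s)) 2s≤N

  r+s<N : r + s < N
  r+s<N = <-≤-trans (+-monoˡ-< s r<s) s+s≤N

  s<N : s < N
  s<N = <-≤-trans (m<m+n s s>0) s+s≤N

  r<N : r < N
  r<N = <-trans r<s s<N

  s≤N : s ≤ N
  s≤N = <⇒≤ s<N

  r≤N : r ≤ N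
  r≤N = <⇒≤ r<N

  N>0 : 0 < N
  N>0 = <-trans s>0 s<N

  k : ℕ
  k = N ∸ (r + s)

  k>0 : 0 < k
  k>0 = m<n⇒0<n∸m r+s<N

  r+s+k≡N : r + s + k ≡ N
  r+s+k≡N = m+[n∸m]≡n (<⇒≤ r+s<N)

  private
    ∸-solve : ∀ {a b c} → a + b ≡ c → c ∸ a ≡ b
    ∸-solve {a} {b} refl = m+n∸m≡n a b

  N∸r≡s+k : N ∸ r ≡ s + k
  N∸r≡s+k = ∸-solve {r} (trans (sym (+-assoc r s k)) r+s+k≡N)

  N∸s≡r+k : N ∸ s ≡ r + k
  N∸s≡r+k = ∸-solve {s} (trans (lemma r s k) r+s+k≡N)
    where lemma : ∀ r s k → s + (r + k) ≡ r + s + k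
          lemma = solve-∀

  r<N∸r : r < N ∸ r
  r<N∸r = subst (r <_) (sym N∸r≡s+k) (<-≤-trans r<s (m≤m+n s k))

  s<N∸r : s < N ∸ r
  s<N∸r = subst (s <_) (sym N∸r≡s+k) (m<m+n s k>0)

  r<N∸s : r < N ∸ s
  r<N∸s = subst (r <_) (sym N∸s≡r+k) (m<m+n r k>0)

  N∸s<N∸r : N ∸ s < N ∸ r
  N∸s<N∸r = subst₂ _<_ (sym N∸s≡r+k) (sym N∸r≡s+k) (+-monoˡ-< k r<s)

  N∸r<N : N ∸ r < N
  N∸r<N = ∸-monoʳ-< r>0 r≤N

  N∸s<N : N ∸ s < N
  N∸s<N = ∸-monoʳ-< s>0 s≤N

  N∸r∸s≡N∸s∸r : N ∸ r ∸ s ≡ N ∸ s ∸ r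
  N∸r∸s≡N∸s∸r = trans (∸-+-assoc N r s) (trans (cong (N ∸_) (+-comm r s)) (sym (∸-+-assoc N s r)))

  N∸s+[s∸r]≡N∸r : N ∸ s + (s ∸ r) ≡ N ∸ r
  N∸s+[s∸r]≡N∸r = begin
    N ∸ s + (s ∸ r)       ≡⟨ cong (_+ (s ∸ r)) N∸s≡r+k ⟩
    r + k + (s ∸ r)       ≡⟨ lemma r k (s ∸ r) ⟩
    k + (r + (s ∸ r))     ≡⟨ cong (k +_) (m+[n∸m]≡n r≤s) ⟩
    k + s                 ≡⟨ trans (+-comm k s) (sym N∸r≡s+k) ⟩
    N ∸ r                 ∎
    where
    open ≡-Reasoning
    lemma : ∀ r k j → r + k + j ≡ k + (r + j)
    lemma = solve-∀

module ExchangeMatrix {N r s : ℕ} (adm : Admissible N r s) where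

  open import Data.Nat as ℕ using (ℕ; zero; suc; _∸_; s≤s)
  import Data.Nat.Properties as ℕ
  open import Data.Integer using (ℤ; +_; 0ℤ; 1ℤ; _+_; _-_; _*_; -_)
  import Data.Integer.Properties as ℤ
  open import Data.Integer.Tactic.RingSolver using (solve-∀)
  open import Relation.Binary.PropositionalEquality
  open Counting
  open IntegerFacts
  open Diagonals
  open DiagonalDifferences
  open Arithmetic adm

  diag₁ diag₂ diag₃ diag₄ diag₅ diag₆ : ℕ → ℕ → ℕ
  diag₁ = diagonal 0 r (N ∸ r)
  diag₂ = diagonal 0 (N ∸ r) r
  diag₃ = diagonal s 0 (N ∸ s)
  diag₄ = diagonal (N ∸ s) 0 s
  diag₅ = diagonal r s (N ∸ r ∸ s)
  diag₆ = diagonal r (N ∸ s) (s ∸ r)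

  GRraw≡diagonals : ∀ u v →
    GRraw N r s u v ≡ diag₁ u v ℕ.+ diag₂ u v ℕ.+ diag₃ u v ℕ.+ diag₄ u v ℕ.+ diag₅ u v ℕ.+ diag₆ u v
  GRraw≡diagonals u v =
    cong₂ ℕ._+_ (cong₂ ℕ._+_ (cong₂ ℕ._+_ (cong₂ ℕ._+_ (cong₂ ℕ._+_
      (family≡diagonal (N ∸ r) (λ i → i) (λ i → i ℕ.+ r) 0 r u v (λ _ → refl) (λ t → ℕ.+-comm (suc t) r))
      (family≡diagonal r (λ j → j) (λ j → N ∸ r ℕ.+ j) 0 (N ∸ r) u v (λ _ → refl) (λ _ → refl)))
      (family≡diagonal (N ∸ s) (λ i → s ℕ.+ i) (λ i → i) s 0 u v (λ _ → refl) (λ _ → refl)))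
      (family≡diagonal s (λ j → N ∸ s ℕ.+ j) (λ j → j) (N ∸ s) 0 u v (λ _ → refl) (λ _ → refl)))
      (family≡diagonal (N ∸ r ∸ s) (λ i → r ℕ.+ i) (λ i → s ℕ.+ i) r s u v (λ _ → refl) (λ _ → refl)))
      (family≡diagonal (s ∸ r) (λ j → r ℕ.+ j) (λ j → N ∸ s ℕ.+ j) r (N ∸ s) u v (λ _ → refl) (λ _ → refl))

  G : ℕ → ℕ → ℤ
  G = Δ (GRraw N r s)

  GR≡[G]₊ : ∀ u v → GR N r s u v ≡ [ G u v ]₊
  GR≡[G]₊ u v = ∸≡[-]₊ (GRraw N r s u v) (GRraw N r s v u)

  G-skew : ∀ u v → G v u ≡ - G u v
  G-skew u v = lemma (+ GRraw N r s u v) (+ GRraw N r s v u)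
    where lemma : ∀ x y → y - x ≡ - (x - y)
          lemma = solve-∀

  G-self : ∀ u → G u u ≡ 0ℤ
  G-self u = lemma (+ GRraw N r s u u)
    where lemma : ∀ x → x - x ≡ 0ℤ
          lemma = solve-∀

  G≡ΣΔ : ∀ u v → G u v ≡ Δ diag₁ u v + Δ diag₂ u v + Δ diag₃ u v + Δ diag₄ u v + Δ diag₅ u v + Δ diag₆ u v
  G≡ΣΔ u v = trans (cong₂ _-_ (toℤ u v) (toℤ v u))
                   (regroup (+ diag₁ u v) (+ diag₂ u v) (+ diag₃ u v) (+ diag₄ u v) (+ diag₅ u v) (+ diag₆ u v)
                            (+ diag₁ v u) (+ diag₂ v u) (+ diag₃ v u) (+ diag₄ v u) (+ diag₅ v u) (+ diag₆ v u))
    where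
    toℤ : ∀ u v → + GRraw N r s u v ≡ + diag₁ u v + + diag₂ u v + + diag₃ u v + + diag₄ u v + + diag₅ u v + + diag₆ u v
    toℤ u v rewrite GRraw≡diagonals u v
                  | ℤ.pos-+ (diag₁ u v ℕ.+ diag₂ u v ℕ.+ diag₃ u v ℕ.+ diag₄ u v ℕ.+ diag₅ u v) (diag₆ u v)
                  | ℤ.pos-+ (diag₁ u v ℕ.+ diag₂ u v ℕ.+ diag₃ u v ℕ.+ diag₄ u v) (diag₅ u v)
                  | ℤ.pos-+ (diag₁ u v ℕ.+ diag₂ u v ℕ.+ diag₃ u v) (diag₄ u v)
                  | ℤ.pos-+ (diag₁ u v ℕ.+ diag₂ u v) (diag₃ u v)
                  | ℤ.pos-+ (diag₁ u v) (diag₂ u v) = refl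
    regroup : ∀ a₁ a₂ a₃ a₄ a₅ a₆ b₁ b₂ b₃ b₄ b₅ b₆ →
              (a₁ + a₂ + a₃ + a₄ + a₅ + a₆) - (b₁ + b₂ + b₃ + b₄ + b₅ + b₆)
              ≡ (a₁ - b₁) + (a₂ - b₂) + (a₃ - b₃) + (a₄ - b₄) + (a₅ - b₅) + (a₆ - b₆)
    regroup = solve-∀

  -- The indicators of a vertex at 1, r+1, s+1, N−s+1, N−r+1 and N+1: the points where the
  -- six diagonals, shifted by one, start or end.
  record Profile : Set where
    constructor ⟨_,_,_,_,_,_⟩
    field
      at-1 at-r+1 at-s+1 at-N∸s+1 at-N∸r+1 at-N+1 : ℤ

  profile : ℕ → Profile
  profile U = ⟨ ι 1 U , ι (suc r) U , ι (suc s) U , ι (suc (N ∸ s)) U , ι (suc (N ∸ r)) U , ι (suc N) U ⟩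

  to-1ᴾ from-1ᴾ : Profile → ℤ
  to-1ᴾ   ⟨ _ , _ , ps , pS , _ , _ ⟩ = ps + pS
  from-1ᴾ ⟨ _ , pr , _ , _ , pR , _ ⟩ = pr + pR

  to-1 from-1 : ℕ → ℤ
  to-1 U   = to-1ᴾ (profile U)
  from-1 U = from-1ᴾ (profile U)

  -- One term [end] − [start] for each of diag₁, …, diag₆.
  boundaryᴾ : Profile → Profile → ℤ
  boundaryᴾ ⟨ p₁ , pr , ps , pS , pR , pN ⟩ ⟨ q₁ , qr , qs , qS , qR , qN ⟩ =
    (pR * qN - p₁ * qr) + (pr * qN - p₁ * qR) + (pN * qS - ps * q₁)
    + (pN * qs - pS * q₁) + (pS * qR - pr * qs) + (ps * qR - pr * qS)

  boundary : ℕ → ℕ → ℤ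
  boundary U V = boundaryᴾ (profile U) (profile V) - boundaryᴾ (profile V) (profile U)

  G-translate : ∀ u v → G u v ≡ G (suc u) (suc v) + boundary (suc u) (suc v)
  G-translate u v = begin
    G u v
      ≡⟨ G≡ΣΔ u v ⟩
    Δ diag₁ u v + Δ diag₂ u v + Δ diag₃ u v + Δ diag₄ u v + Δ diag₅ u v + Δ diag₆ u v
      ≡⟨ cong₂ _+_ (cong₂ _+_ (cong₂ _+_ (cong₂ _+_ (cong₂ _+_
           (Δ-diagonal-translate 0 r (N ∸ r) u v refl (ℕ.+-comm r 1) refl (m+[1+n∸m]≡1+n r≤N))
           (Δ-diagonal-translate 0 (N ∸ r) r u v refl (ℕ.+-comm (N ∸ r) 1) refl ([n∸m]+[1+m]≡1+n r≤N)))
           (Δ-diagonal-translate s 0 (N ∸ s) u v (ℕ.+-comm s 1) refl (m+[1+n∸m]≡1+n s≤N) refl))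
           (Δ-diagonal-translate (N ∸ s) 0 s u v (ℕ.+-comm (N ∸ s) 1) refl ([n∸m]+[1+m]≡1+n s≤N) refl))
           (Δ-diagonal-translate r s (N ∸ r ∸ s) u v (ℕ.+-comm r 1) (ℕ.+-comm s 1)
              (trans (cong (λ M → r ℕ.+ suc M) N∸r∸s≡N∸s∸r) (m+[1+n∸m]≡1+n (ℕ.<⇒≤ r<N∸s)))
              (m+[1+n∸m]≡1+n (ℕ.<⇒≤ s<N∸r))))
           (Δ-diagonal-translate r (N ∸ s) (s ∸ r) u v (ℕ.+-comm r 1) (ℕ.+-comm (N ∸ s) 1) (m+[1+n∸m]≡1+n r≤s)
              (trans (ℕ.+-suc (N ∸ s) (s ∸ r)) (cong suc N∸s+[s∸r]≡N∸r))) ⟩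
    (Δ diag₁ U V + e₁ U V - e₁ V U) + (Δ diag₂ U V + e₂ U V - e₂ V U) + (Δ diag₃ U V + e₃ U V - e₃ V U)
      + (Δ diag₄ U V + e₄ U V - e₄ V U) + (Δ diag₅ U V + e₅ U V - e₅ V U) + (Δ diag₆ U V + e₆ U V - e₆ V U)
      ≡⟨ regroup (Δ diag₁ U V) (Δ diag₂ U V) (Δ diag₃ U V) (Δ diag₄ U V) (Δ diag₅ U V) (Δ diag₆ U V)
                 (e₁ U V) (e₂ U V) (e₃ U V) (e₄ U V) (e₅ U V) (e₆ U V)
                 (e₁ V U) (e₂ V U) (e₃ V U) (e₄ V U) (e₅ V U) (e₆ V U) ⟩
    (Δ diag₁ U V + Δ diag₂ U V + Δ diag₃ U V + Δ diag₄ U V + Δ diag₅ U V + Δ diag₆ U V) + boundary U V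
      ≡⟨ cong (_+ boundary U V) (sym (G≡ΣΔ U V)) ⟩
    G U V + boundary U V ∎
    where
    open ≡-Reasoning
    U = suc u
    V = suc v
    corner : ℕ → ℕ → ℕ → ℕ → ℤ
    corner p q X Y = ι p X * ι q Y
    e₁ e₂ e₃ e₄ e₅ e₆ : ℕ → ℕ → ℤ
    e₁ X Y = corner (suc (N ∸ r)) (suc N) X Y - corner 1 (suc r) X Y
    e₂ X Y = corner (suc r) (suc N) X Y - corner 1 (suc (N ∸ r)) X Y
    e₃ X Y = corner (suc N) (suc (N ∸ s)) X Y - corner (suc s) 1 X Y
    e₄ X Y = corner (suc N) (suc s) X Y - corner (suc (N ∸ s)) 1 X Y
    e₅ X Y = corner (suc (N ∸ s)) (suc (N ∸ r)) X Y - corner (suc r) (suc s) X Y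
    e₆ X Y = corner (suc s) (suc (N ∸ r)) X Y - corner (suc r) (suc (N ∸ s)) X Y
    regroup : ∀ x₁ x₂ x₃ x₄ x₅ x₆ e₁ e₂ e₃ e₄ e₅ e₆ f₁ f₂ f₃ f₄ f₅ f₆ →
      (x₁ + e₁ - f₁) + (x₂ + e₂ - f₂) + (x₃ + e₃ - f₃) + (x₄ + e₄ - f₄) + (x₅ + e₅ - f₅) + (x₆ + e₆ - f₆)
      ≡ (x₁ + x₂ + x₃ + x₄ + x₅ + x₆) + ((e₁ + e₂ + e₃ + e₄ + e₅ + e₆) - (f₁ + f₂ + f₃ + f₄ + f₅ + f₆))
    regroup = solve-∀

  boundaryᴾ-interior : ∀ pr ps pS pR qr qs qS qR →
      boundaryᴾ ⟨ 0ℤ , pr , ps , pS , pR , 0ℤ ⟩ ⟨ 0ℤ , qr , qs , qS , qR , 0ℤ ⟩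
    - boundaryᴾ ⟨ 0ℤ , qr , qs , qS , qR , 0ℤ ⟩ ⟨ 0ℤ , pr , ps , pS , pR , 0ℤ ⟩
    ≡ (ps + pS) * (qr + qR) - (qs + qS) * (pr + pR)
  boundaryᴾ-interior = identity
    where
    identity : ∀ pr ps pS pR qr qs qS qR →
        ((pR * 0ℤ - 0ℤ * qr) + (pr * 0ℤ - 0ℤ * qR) + (0ℤ * qS - ps * 0ℤ)
         + (0ℤ * qs - pS * 0ℤ) + (pS * qR - pr * qs) + (ps * qR - pr * qS))
      - ((qR * 0ℤ - 0ℤ * pr) + (qr * 0ℤ - 0ℤ * pR) + (0ℤ * pS - qs * 0ℤ)
         + (0ℤ * ps - qS * 0ℤ) + (qS * pR - qr * ps) + (qs * pR - qr * pS))
      ≡ (ps + pS) * (qr + qR) - (qs + qS) * (pr + pR)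
    identity = solve-∀

  boundaryᴾ-from-1 : ∀ q₁ qr qs qS qR qN →
      boundaryᴾ ⟨ 1ℤ , 0ℤ , 0ℤ , 0ℤ , 0ℤ , 0ℤ ⟩ ⟨ q₁ , qr , qs , qS , qR , qN ⟩
    - boundaryᴾ ⟨ q₁ , qr , qs , qS , qR , qN ⟩ ⟨ 1ℤ , 0ℤ , 0ℤ , 0ℤ , 0ℤ , 0ℤ ⟩
    ≡ (qs + qS) - (qr + qR)
  boundaryᴾ-from-1 = identity
    where
    identity : ∀ q₁ qr qs qS qR qN →
        ((0ℤ * qN - 1ℤ * qr) + (0ℤ * qN - 1ℤ * qR) + (0ℤ * qS - 0ℤ * q₁)
         + (0ℤ * qs - 0ℤ * q₁) + (0ℤ * qR - 0ℤ * qs) + (0ℤ * qR - 0ℤ * qS))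
      - ((qR * 0ℤ - q₁ * 0ℤ) + (qr * 0ℤ - q₁ * 0ℤ) + (qN * 0ℤ - qs * 1ℤ)
         + (qN * 0ℤ - qS * 1ℤ) + (qS * 0ℤ - qr * 0ℤ) + (qs * 0ℤ - qr * 0ℤ))
      ≡ (qs + qS) - (qr + qR)
    identity = solve-∀

  boundaryᴾ-from-N+1 : ∀ q₁ qr qs qS qR qN →
      boundaryᴾ ⟨ 0ℤ , 0ℤ , 0ℤ , 0ℤ , 0ℤ , 1ℤ ⟩ ⟨ q₁ , qr , qs , qS , qR , qN ⟩
    - boundaryᴾ ⟨ q₁ , qr , qs , qS , qR , qN ⟩ ⟨ 0ℤ , 0ℤ , 0ℤ , 0ℤ , 0ℤ , 1ℤ ⟩
    ≡ (qs + qS) - (qr + qR)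
  boundaryᴾ-from-N+1 = identity
    where
    identity : ∀ q₁ qr qs qS qR qN →
        ((0ℤ * qN - 0ℤ * qr) + (0ℤ * qN - 0ℤ * qR) + (1ℤ * qS - 0ℤ * q₁)
         + (1ℤ * qs - 0ℤ * q₁) + (0ℤ * qR - 0ℤ * qs) + (0ℤ * qR - 0ℤ * qS))
      - ((qR * 1ℤ - q₁ * 0ℤ) + (qr * 1ℤ - q₁ * 0ℤ) + (qN * 0ℤ - qs * 0ℤ)
         + (qN * 0ℤ - qS * 0ℤ) + (qS * 0ℤ - qr * 0ℤ) + (qs * 0ℤ - qr * 0ℤ))
      ≡ (qs + qS) - (qr + qR)
    identity = solve-∀

  ⟨⟩-cong : ∀ {a b c d e f a′ b′ c′ d′ e′ f′} →
            a ≡ a′ → b ≡ b′ → c ≡ c′ → d ≡ d′ → e ≡ e′ → f ≡ f′ →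
            ⟨ a , b , c , d , e , f ⟩ ≡ ⟨ a′ , b′ , c′ , d′ , e′ , f′ ⟩
  ⟨⟩-cong refl refl refl refl refl refl = refl

  profile-interior : ∀ {U} → 1 ℕ.< U → U ℕ.≤ N →
    profile U ≡ ⟨ 0ℤ , ι (suc r) U , ι (suc s) U , ι (suc (N ∸ s)) U , ι (suc (N ∸ r)) U , 0ℤ ⟩
  profile-interior 1<U U≤N = ⟨⟩-cong (ι-below 1<U) refl refl refl refl (ι-above (s≤s U≤N))

  profile-1 : profile 1 ≡ ⟨ 1ℤ , 0ℤ , 0ℤ , 0ℤ , 0ℤ , 0ℤ ⟩
  profile-1 = ⟨⟩-cong refl (ι-above (s≤s r>0)) (ι-above (s≤s s>0)) (ι-above (s≤s (ℕ.m<n⇒0<n∸m s<N)))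
                           (ι-above (s≤s (ℕ.m<n⇒0<n∸m r<N))) (ι-above (s≤s N>0))

  profile-N+1 : profile (suc N) ≡ ⟨ 0ℤ , 0ℤ , 0ℤ , 0ℤ , 0ℤ , 1ℤ ⟩
  profile-N+1 = ⟨⟩-cong (ι-below (s≤s N>0)) (ι-below (s≤s r<N)) (ι-below (s≤s s<N)) (ι-below (s≤s N∸s<N))
                        (ι-below (s≤s N∸r<N)) (cong +_ (δ-refl N))

  to-1-beyond : ∀ {U} → N ℕ.< U → to-1 U ≡ 0ℤ
  to-1-beyond N<U = cong₂ _+_ (ι-below (ℕ.<-≤-trans (s≤s s<N) N<U)) (ι-below (ℕ.<-≤-trans (s≤s N∸s<N) N<U))

  from-1-beyond : ∀ {U} → N ℕ.< U → from-1 U ≡ 0ℤ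
  from-1-beyond N<U = cong₂ _+_ (ι-below (ℕ.<-≤-trans (s≤s r<N) N<U)) (ι-below (ℕ.<-≤-trans (s≤s N∸r<N) N<U))

  GRraw-outside : ∀ {u v} → Outside N u v → GRraw N r s u v ≡ 0
  GRraw-outside {u} {v} out
    rewrite GRraw≡diagonals u v
          | diagonal-outside 0 r (N ∸ r) (ℕ.m∸n≤m N r) (ℕ.≤-reflexive (ℕ.m+[n∸m]≡n r≤N)) out
          | diagonal-outside 0 (N ∸ r) r r≤N (ℕ.≤-reflexive (ℕ.m∸n+n≡m r≤N)) out
          | diagonal-outside s 0 (N ∸ s) (ℕ.≤-reflexive (ℕ.m+[n∸m]≡n s≤N)) (ℕ.m∸n≤m N s) out
          | diagonal-outside (N ∸ s) 0 s (ℕ.≤-reflexive (ℕ.m∸n+n≡m s≤N)) s≤N out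
          | diagonal-outside r s (N ∸ r ∸ s)
              (subst (λ M → r ℕ.+ M ℕ.≤ N) (sym N∸r∸s≡N∸s∸r)
                     (ℕ.≤-trans (ℕ.≤-reflexive (ℕ.m+[n∸m]≡n (ℕ.<⇒≤ r<N∸s))) (ℕ.m∸n≤m N s)))
              (ℕ.≤-trans (ℕ.≤-reflexive (ℕ.m+[n∸m]≡n (ℕ.<⇒≤ s<N∸r))) (ℕ.m∸n≤m N r)) out
          | diagonal-outside r (N ∸ s) (s ∸ r) (ℕ.≤-trans (ℕ.≤-reflexive (ℕ.m+[n∸m]≡n r≤s)) s≤N)
              (ℕ.≤-trans (ℕ.≤-reflexive N∸s+[s∸r]≡N∸r) (ℕ.m∸n≤m N r)) out
          = refl

  G-outside : ∀ {u v} → Outside N u v → G u v ≡ 0ℤ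
  G-outside out rewrite GRraw-outside out | GRraw-outside (Outside-swap out) = refl

  G-interior : ∀ {u v} → 1 ℕ.≤ u → u ℕ.< N → 1 ℕ.≤ v → v ℕ.< N →
    G u v ≡ G (suc u) (suc v) + (to-1 (suc u) * from-1 (suc v) - to-1 (suc v) * from-1 (suc u))
  G-interior {u} {v} 1≤u u<N 1≤v v<N = trans (G-translate u v) (cong (λ b → G U V + b) (begin
    boundary U V
      ≡⟨ cong₂ (λ p q → boundaryᴾ p q - boundaryᴾ q p) (profile-interior (s≤s 1≤u) u<N) (profile-interior (s≤s 1≤v) v<N) ⟩
    _ ≡⟨ boundaryᴾ-interior (ι (suc r) U) (ι (suc s) U) (ι (suc (N ∸ s)) U) (ι (suc (N ∸ r)) U)
                            (ι (suc r) V) (ι (suc s) V) (ι (suc (N ∸ s)) V) (ι (suc (N ∸ r)) V) ⟩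
    to-1 U * from-1 V - to-1 V * from-1 U ∎))
    where
    open ≡-Reasoning
    U = suc u
    V = suc v

  boundary-1 : ∀ V → boundary 1 V ≡ to-1 V - from-1 V
  boundary-1 V = trans (cong (λ p → boundaryᴾ p (profile V) - boundaryᴾ (profile V) p) profile-1)
    (boundaryᴾ-from-1 (ι 1 V) (ι (suc r) V) (ι (suc s) V) (ι (suc (N ∸ s)) V) (ι (suc (N ∸ r)) V) (ι (suc N) V))

  boundary-N+1 : ∀ V → boundary (suc N) V ≡ to-1 V - from-1 V
  boundary-N+1 V = trans (cong (λ p → boundaryᴾ p (profile V) - boundaryᴾ (profile V) p) profile-N+1)
    (boundaryᴾ-from-N+1 (ι 1 V) (ι (suc r) V) (ι (suc s) V) (ι (suc (N ∸ s)) V) (ι (suc (N ∸ r)) V) (ι (suc N) V))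

  G-first-row : ∀ v → G 1 v ≡ from-1 v - to-1 v
  G-first-row zero    = G-outside (tgt-zero refl)
  G-first-row (suc v) = begin
    G 1 V                                 ≡⟨ sym (cancel (G 1 V) (boundary 1 V)) ⟩
    G 1 V + boundary 1 V - boundary 1 V   ≡⟨ cong₂ _-_ (trans (sym (G-translate 0 v)) (G-outside (src-zero refl))) (boundary-1 V) ⟩
    0ℤ - (to-1 V - from-1 V)              ≡⟨ negate (to-1 V) (from-1 V) ⟩
    from-1 V - to-1 V                     ∎
    where
    open ≡-Reasoning
    V = suc v
    cancel : ∀ x y → x + y - y ≡ x
    cancel = solve-∀
    negate : ∀ x y → 0ℤ - (x - y) ≡ y - x
    negate = solve-∀

  G-last-row : ∀ v → G N v ≡ to-1 (suc v) - from-1 (suc v)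
  G-last-row v = trans (G-translate N v)
    (trans (cong₂ _+_ (G-outside (src-beyond (ℕ.n<1+n N))) (boundary-N+1 (suc v))) (ℤ.+-identityˡ _))

module FrozenEntries {N r s : ℕ} (adm : Admissible N r s) where

  open import Data.Nat as ℕ using (ℕ; suc; _∸_; s≤s; _≤?_; _<?_; >-nonZero)
  import Data.Nat.Properties as ℕ
  open import Data.Integer using (ℤ; +_; -[1+_]; 0ℤ; 1ℤ; _+_; _-_; _*_; -_)
  import Data.Integer.Properties as ℤ
  open import Data.Integer.Tactic.RingSolver using (solve-∀)
  open import Data.Bool using (if_then_else_; _∧_)
  open import Data.Bool.Properties using (∧-zeroʳ)
  open import Data.Product using (_,_)
  open import Data.Sum using (inj₁; inj₂)
  open import Relation.Nullary using (does; yes; no)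
  open import Relation.Nullary.Decidable using (dec-true; dec-false)
  open import Relation.Binary.PropositionalEquality
  open import Relation.Binary.Definitions using (tri<; tri≈; tri>)
  open Counting
  open IntegerFacts
  open DiagonalDifferences using (ι-above; ι-below)
  open Arithmetic adm
  open ExchangeMatrix adm
  open RepresentationCount r (N ∸ r) {{>-nonZero r>0}} {{>-nonZero (ℕ.m<n⇒0<n∸m r<N)}}

  F : ℕ → ℤ → ℤ
  F v z = if does (v ≤? r) then + D z
          else if does (v ≤? N ∸ r) then + D z - + D (z - + r)
          else δ₀ z - + D (z - + N)

  F-low : ∀ {v} z → v ℕ.≤ r → F v z ≡ + D z
  F-low {v} z v≤r rewrite dec-true (v ≤? r) v≤r = refl

  F-middle : ∀ {v} z → r ℕ.< v → v ℕ.≤ N ∸ r → F v z ≡ + D z - + D (z - + r)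
  F-middle {v} z r<v v≤N∸r rewrite dec-false (v ≤? r) (ℕ.<⇒≱ r<v) | dec-true (v ≤? N ∸ r) v≤N∸r = refl

  F-high : ∀ {v} z → N ∸ r ℕ.< v → F v z ≡ δ₀ z - + D (z - + N)
  F-high {v} z N∸r<v
    rewrite dec-false (v ≤? r) (ℕ.<⇒≱ (ℕ.<-trans r<N∸r N∸r<v)) | dec-false (v ≤? N ∸ r) (ℕ.<⇒≱ N∸r<v) = refl

  private
    recurrence-step : ∀ w z {x y c d} → F w z ≡ x → F (suc w) z ≡ y → from-1 (suc w) ≡ c → x ≡ y + c * d →
           F w z ≡ F (suc w) z + from-1 (suc w) * d
    recurrence-step w z refl refl refl eq = eq

    no-change : ∀ x d → x ≡ x + (0ℤ + 0ℤ) * d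
    no-change = solve-∀

    enter-middle : ∀ x d → x ≡ (x - d) + (1ℤ + 0ℤ) * d
    enter-middle = solve-∀

  F-recurrence : ∀ {w} z → 1 ℕ.≤ w → w ℕ.< N → F w z ≡ F (suc w) z + from-1 (suc w) * + D (z - + w)
  F-recurrence {w} z 1≤w w<N with ℕ.<-cmp w r
  ... | tri< w<r _ _ =
    recurrence-step w z (F-low z (ℕ.<⇒≤ w<r)) (F-low z w<r)
         (cong₂ _+_ (ι-above (s≤s w<r)) (ι-above (s≤s (ℕ.<-trans w<r r<N∸r)))) (no-change (+ D z) (+ D (z - + w)))
  ... | tri≈ _ refl _ =
    recurrence-step w z (F-low z ℕ.≤-refl) (F-middle z (ℕ.n<1+n r) r<N∸r)
         (cong₂ _+_ (cong +_ (δ-refl (suc r))) (ι-above (s≤s r<N∸r))) (enter-middle (+ D z) (+ D (z - + r)))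
  ... | tri> _ _ r<w with ℕ.<-cmp w (N ∸ r)
  ...   | tri< w<N∸r _ _ =
    recurrence-step w z (F-middle z r<w (ℕ.<⇒≤ w<N∸r)) (F-middle z (ℕ.<-trans r<w (ℕ.n<1+n w)) w<N∸r)
         (cong₂ _+_ (ι-below (s≤s r<w)) (ι-above (s≤s w<N∸r))) (no-change (+ D z - + D (z - + r)) (+ D (z - + w)))
  ...   | tri≈ _ refl _ =
    recurrence-step w z (F-middle z r<w ℕ.≤-refl) (F-high z (ℕ.n<1+n (N ∸ r)))
         (cong₂ _+_ (ι-below (s≤s r<w)) (cong +_ (δ-refl (suc (N ∸ r))))) enter-high
    where
    z-[N∸r]-r≡z-N : z - + (N ∸ r) - + r ≡ z - + N
    z-[N∸r]-r≡z-N = trans (assoc z (+ (N ∸ r)) (+ r))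
                          (cong (λ n → z - n) (trans (sym (ℤ.pos-+ (N ∸ r) r)) (cong +_ (ℕ.m∸n+n≡m r≤N))))
      where assoc : ∀ a b c → a - b - c ≡ a - (b + c)
            assoc = solve-∀
    enter-high : + D z - + D (z - + r) ≡ (δ₀ z - + D (z - + N)) + (0ℤ + 1ℤ) * + D (z - + (N ∸ r))
    enter-high = begin
      + D z - + D (z - + r)
        ≡⟨ D-second-difference z ⟩
      δ₀ z + (+ D (z - + (N ∸ r)) - + D (z - + (N ∸ r) - + r))
        ≡⟨ cong (λ y → δ₀ z + (+ D (z - + (N ∸ r)) - + D y)) z-[N∸r]-r≡z-N ⟩
      δ₀ z + (+ D (z - + (N ∸ r)) - + D (z - + N))
        ≡⟨ rearrange (δ₀ z) (+ D (z - + (N ∸ r))) (+ D (z - + N)) ⟩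
      (δ₀ z - + D (z - + N)) + (0ℤ + 1ℤ) * + D (z - + (N ∸ r)) ∎
      where
      open ≡-Reasoning
      rearrange : ∀ a b c → a + (b - c) ≡ (a - c) + (0ℤ + 1ℤ) * b
      rearrange = solve-∀
  ...   | tri> _ _ N∸r<w =
    recurrence-step w z (F-high z N∸r<w) (F-high z (ℕ.<-trans N∸r<w (ℕ.n<1+n w)))
         (cong₂ _+_ (ι-below (s≤s (ℕ.<-trans r<N∸r N∸r<w))) (ι-below (s≤s N∸r<w))) (no-change (δ₀ z - + D (z - + N)) (+ D (z - + w)))

  data Regime (v : ℕ) : Set where
    low    : v ℕ.≤ r → Regime v
    middle : r ℕ.< v → v ℕ.≤ N ∸ r → Regime v
    high   : N ∸ r ℕ.< v → Regime v

  regime : ∀ v → Regime v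
  regime v with v ≤? r | v ≤? N ∸ r
  ... | yes v≤r | _          = low v≤r
  ... | no  v≰r | yes v≤N∸r  = middle (ℕ.≰⇒> v≰r) v≤N∸r
  ... | no  _   | no  v≰N∸r  = high (ℕ.≰⇒> v≰N∸r)

  F-negative : ∀ v q → F v -[1+ q ] ≡ 0ℤ
  F-negative v q with regime v
  ... | low v≤r          = F-low -[1+ q ] v≤r
  ... | middle r<v v≤N∸r rewrite F-middle -[1+ q ] r<v v≤N∸r | -[1+]-+ q r = refl
  ... | high N∸r<v       rewrite F-high -[1+ q ] N∸r<v | -[1+]-+ q N = refl

  F-small : ∀ {v x} → x ℕ.< v → v ℕ.≤ N → F v (+ x) ≡ + δ 0 x
  F-small {v} {x} x<v v≤N with regime v
  ... | low v≤r =
    trans (F-low (+ x) v≤r) (cong +_ (D-small x (ℕ.<-≤-trans x<v v≤r) (ℕ.<-≤-trans x<v (ℕ.≤-trans v≤r (ℕ.<⇒≤ r<N∸r)))))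
  ... | middle r<v v≤N∸r = trans (F-middle (+ x) r<v v≤N∸r) (D-difference-small x (ℕ.<-≤-trans x<v v≤N∸r))
  ... | high N∸r<v with +-∸-< (ℕ.<-≤-trans x<v v≤N)
  ...   | _ , x-N≡neg rewrite F-high (+ x) N∸r<v | x-N≡neg = trans (ℤ.+-identityʳ (δ₀ (+ x))) (δ₀-+ x)

  F-initial : ∀ {v i} → 1 ℕ.≤ i → v ℕ.≤ N → F v (+ v - + i) ≡ + δ v i
  F-initial {v} {i} 1≤i v≤N with ℕ.≤-<-connex i v
  ... | inj₁ i≤v rewrite +-∸-≥ i≤v =
    trans (F-small (ℕ.∸-monoʳ-< 1≤i i≤v) v≤N) (cong +_ (δ-0-∸ i≤v))
  ... | inj₂ v<i with +-∸-< v<i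
  ...   | q , v-i≡neg rewrite v-i≡neg = trans (F-negative v q) (sym (cong +_ (δ-≢ (ℕ.<⇒≢ v<i))))

  F-1 : ∀ z → F 1 z ≡ + D z
  F-1 z = F-low z r>0

  F-N : ∀ m {i} → i ℕ.≤ N → F N (+ (suc m ℕ.+ N) - + i) ≡ - F 1 (+ (m ℕ.+ 1) - + i)
  F-N m {i} i≤N = begin
    F N z                                  ≡⟨ F-high z N∸r<N ⟩
    δ₀ z - + D (z - + N)                   ≡⟨ cong₂ (λ a y → a - + D y) δ₀z≡0 z-N≡m+1-i ⟩
    0ℤ - + D (+ (m ℕ.+ 1) - + i)           ≡⟨ ℤ.+-identityˡ _ ⟩
    - + D (+ (m ℕ.+ 1) - + i)              ≡⟨ cong -_ (sym (F-1 (+ (m ℕ.+ 1) - + i))) ⟩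
    - F 1 (+ (m ℕ.+ 1) - + i)              ∎
    where
    open ≡-Reasoning
    z = + (suc m ℕ.+ N) - + i
    δ₀z≡0 : δ₀ z ≡ 0ℤ
    δ₀z≡0 rewrite +-∸-≥ (ℕ.≤-trans i≤N (ℕ.m≤n+m N (suc m))) | ℕ.+-∸-assoc (suc m) i≤N = refl
    z-N≡m+1-i : z - + N ≡ + (m ℕ.+ 1) - + i
    z-N≡m+1-i = begin
      + (suc m ℕ.+ N) - + i - + N     ≡⟨ cong (λ n → + n - + i - + N) (cong (ℕ._+ N) (ℕ.+-comm 1 m)) ⟩
      + (m ℕ.+ 1 ℕ.+ N) - + i - + N   ≡⟨ cong (λ a → a - + i - + N) (ℤ.pos-+ (m ℕ.+ 1) N) ⟩
      + (m ℕ.+ 1) + + N - + i - + N   ≡⟨ cancel (+ (m ℕ.+ 1)) (+ N) (+ i) ⟩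
      + (m ℕ.+ 1) - + i               ∎
      where cancel : ∀ a b c → a + b - c - b ≡ a - c
            cancel = solve-∀

  -- After m mutations there are Fr m (N + i) v arrows from the frozen vertex N + i to the
  -- mutable vertex labelled v (negative: arrows the other way).
  Fr : ℕ → ℕ → ℕ → ℤ
  Fr m u v = if does (N <? u) ∧ does (u ≤? N ℕ.+ N) ∧ does (1 ≤? v) ∧ does (v ≤? N)
             then F v (+ (m ℕ.+ v) - + (u ∸ N)) else 0ℤ

  data Layer (u : ℕ) : Set where
    lower  : u ℕ.≤ N → Layer u
    frozen : N ℕ.< u → u ℕ.≤ N ℕ.+ N → Layer u
    upper  : N ℕ.+ N ℕ.< u → Layer u

  layer : ∀ u → Layer u
  layer u with N <? u | u ≤? N ℕ.+ N
  ... | no  N≮u | _         = lower (ℕ.≮⇒≥ N≮u)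
  ... | yes N<u | yes u≤2N  = frozen N<u u≤2N
  ... | yes _   | no  u≰2N  = upper (ℕ.≰⇒> u≰2N)

  Fr-frozen : ∀ m {u v} → N ℕ.< u → u ℕ.≤ N ℕ.+ N → 1 ℕ.≤ v → v ℕ.≤ N →
              Fr m u v ≡ F v (+ (m ℕ.+ v) - + (u ∸ N))
  Fr-frozen m {u} {v} N<u u≤2N 1≤v v≤N
    rewrite dec-true (N <? u) N<u | dec-true (u ≤? N ℕ.+ N) u≤2N | dec-true (1 ≤? v) 1≤v | dec-true (v ≤? N) v≤N = refl

  Fr-lower : ∀ m {u} v → u ℕ.≤ N → Fr m u v ≡ 0ℤ
  Fr-lower m {u} v u≤N rewrite dec-false (N <? u) (ℕ.≤⇒≯ u≤N) = refl

  Fr-upper : ∀ m {u} v → N ℕ.+ N ℕ.< u → Fr m u v ≡ 0ℤ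
  Fr-upper m {u} v 2N<u rewrite dec-false (u ≤? N ℕ.+ N) (ℕ.<⇒≱ 2N<u) | ∧-zeroʳ (does (N <? u)) = refl

  Fr-to-0 : ∀ m u → Fr m u 0 ≡ 0ℤ
  Fr-to-0 m u rewrite ∧-zeroʳ (does (u ≤? N ℕ.+ N)) | ∧-zeroʳ (does (N <? u)) = refl

  Fr-to-upper : ∀ m u {v} → N ℕ.< v → Fr m u v ≡ 0ℤ
  Fr-to-upper m u {v} N<v rewrite dec-false (v ≤? N) (ℕ.<⇒≱ N<v) | ∧-zeroʳ (does (1 ≤? v))
    | ∧-zeroʳ (does (u ≤? N ℕ.+ N)) | ∧-zeroʳ (does (N <? u)) = refl

  Fr-to-1 : ∀ m {u} → N ℕ.< u → u ℕ.≤ N ℕ.+ N → Fr m u 1 ≡ + D (+ (m ℕ.+ 1) - + (u ∸ N))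
  Fr-to-1 m {u} N<u u≤2N = trans (Fr-frozen m N<u u≤2N ℕ.≤-refl N>0) (F-1 (+ (m ℕ.+ 1) - + (u ∸ N)))

  Fr-to-1-nonneg : ∀ m u → Fr m u 1 ≡ + [ Fr m u 1 ]₊
  Fr-to-1-nonneg m u with layer u
  ... | lower u≤N         rewrite Fr-lower m 1 u≤N = refl
  ... | frozen N<u u≤2N   rewrite Fr-to-1 m N<u u≤2N = refl
  ... | upper 2N<u        rewrite Fr-upper m 1 2N<u = refl

module Periodicity {N r s : ℕ} (adm : Admissible N r s) where

  open import Data.Nat as ℕ using (ℕ; suc; _∸_; s≤s; z≤n; >-nonZero)
  import Data.Nat.Properties as ℕ
  open import Data.Integer using (ℤ; +_; 0ℤ; _+_; _-_; _*_; -_)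
  import Data.Integer.Properties as ℤ
  open import Data.Integer.Tactic.RingSolver using (solve-∀)
  open import Data.Sum using (_⊎_; inj₁; inj₂; swap)
  open import Relation.Nullary using (yes; no; contradiction)
  open import Relation.Binary.PropositionalEquality
  open Counting
  open IntegerFacts
  open Diagonals using (diagonal; family≡diagonal; src-zero; tgt-zero; src-beyond; tgt-beyond)
  open Arithmetic adm
  open ExchangeMatrix adm
  open FrozenEntries adm
  open RepresentationCount r (N ∸ r) {{>-nonZero r>0}} {{>-nonZero (ℕ.m<n⇒0<n∸m r<N)}} using (D)
  open Rotation N {{>-nonZero N>0}}
  open MatrixMutation

  private
    vanishing-src : ∀ {g′ g a b c d} → g′ ≡ 0ℤ → g ≡ 0ℤ → a ≡ 0ℤ → b ≡ 0ℤ → g′ ≡ g + (a * c - d * b)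
    vanishing-src {c = c} {d} refl refl refl refl = identity c d
      where identity : ∀ c d → 0ℤ ≡ 0ℤ + (0ℤ * c - d * 0ℤ)
            identity = solve-∀

    vanishing-tgt : ∀ {g′ g a b c d} → g′ ≡ 0ℤ → g ≡ 0ℤ → d ≡ 0ℤ → c ≡ 0ℤ → g′ ≡ g + (a * c - d * b)
    vanishing-tgt {a = a} {b} refl refl refl refl = identity a b
      where identity : ∀ a b → 0ℤ ≡ 0ℤ + (a * 0ℤ - 0ℤ * b)
            identity = solve-∀

    sum-difference-cong : ∀ {a a′ b b′ c c′} → a ≡ a′ → b ≡ b′ → c ≡ c′ → a + b - c ≡ a′ + b′ - c′
    sum-difference-cong refl refl refl = refl

  G-rotate : ∀ {u v} → u ≢ 1 → v ≢ 1 → G (σ u) (σ v) ≡ G u v + (to-1 u * from-1 v - to-1 v * from-1 u)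
  G-rotate {u} {v} u≢1 v≢1 with position u | position v
  ... | at-1 | _    = contradiction refl u≢1
  ... | _    | at-1 = contradiction refl v≢1
  ... | at-0 | _    = vanishing-src {c = from-1 v} {to-1 v} (G-outside (src-zero refl)) (G-outside (src-zero refl)) refl refl
  ... | beyond N<u | _ rewrite σ-beyond N<u =
    vanishing-src {c = from-1 v} {to-1 v} (G-outside (src-beyond N<u)) (G-outside (src-beyond N<u)) (to-1-beyond N<u) (from-1-beyond N<u)
  ... | interior _ _ _ | at-0 = vanishing-tgt {a = to-1 u} {from-1 u} (G-outside (tgt-zero refl)) (G-outside (tgt-zero refl)) refl refl
  ... | interior _ _ _ | beyond N<v rewrite σ-beyond N<v =
    vanishing-tgt {a = to-1 u} {from-1 u} (G-outside (tgt-beyond N<v)) (G-outside (tgt-beyond N<v)) (to-1-beyond N<v) (from-1-beyond N<v)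
  ... | interior w₁ 1≤w₁ w₁<N | interior w₂ 1≤w₂ w₂<N rewrite σ-interior 1≤w₁ w₁<N | σ-interior 1≤w₂ w₂<N =
    G-interior 1≤w₁ w₁<N 1≤w₂ w₂<N

  G-N-σ : ∀ v → G N (σ v) ≡ - G 1 v
  G-N-σ v with position v
  ... | at-0               = trans (G-outside (tgt-zero refl)) (sym (cong -_ (G-outside (tgt-zero refl))))
  ... | at-1               = trans (G-self N) (sym (cong -_ (G-self 1)))
  ... | interior w 1≤w w<N = begin
    G N (σ (suc w))                     ≡⟨ cong (G N) (σ-interior 1≤w w<N) ⟩
    G N w                               ≡⟨ G-last-row w ⟩
    to-1 (suc w) - from-1 (suc w)       ≡⟨ antisym (to-1 (suc w)) (from-1 (suc w)) ⟩
    - (from-1 (suc w) - to-1 (suc w))   ≡⟨ cong -_ (sym (G-first-row (suc w))) ⟩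
    - G 1 (suc w)                       ∎
    where
    open ≡-Reasoning
    antisym : ∀ a b → a - b ≡ - (b - a)
    antisym = solve-∀
  ... | beyond N<v = begin
    G N (σ v)    ≡⟨ cong (G N) (σ-beyond N<v) ⟩
    G N v        ≡⟨ G-outside (tgt-beyond N<v) ⟩
    0ℤ           ≡⟨ sym (cong -_ (G-outside (tgt-beyond N<v))) ⟩
    - G 1 v      ∎
    where open ≡-Reasoning

  arrows-to-1 arrows-from-1 : ℕ → ℕ
  arrows-to-1   U = δ (suc s) U ℕ.+ δ (suc (N ∸ s)) U
  arrows-from-1 U = δ (suc r) U ℕ.+ δ (suc (N ∸ r)) U

  to-1≡ : ∀ U → to-1 U ≡ + arrows-to-1 U
  to-1≡ U = sym (ℤ.pos-+ (δ (suc s) U) (δ (suc (N ∸ s)) U))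

  from-1≡ : ∀ U → from-1 U ≡ + arrows-from-1 U
  from-1≡ U = sym (ℤ.pos-+ (δ (suc r) U) (δ (suc (N ∸ r)) U))

  arrows-to-1-or-from-1 : ∀ U → arrows-to-1 U ≡ 0 ⊎ arrows-from-1 U ≡ 0
  arrows-to-1-or-from-1 U with U ℕ.≟ suc s | U ℕ.≟ suc (N ∸ s)
  ... | yes refl | _        = inj₂ (cong₂ ℕ._+_ (δ-≢ (λ e → ℕ.<⇒≢ r<s (ℕ.suc-injective e)))
                                                 (δ-≢ (λ e → ℕ.<⇒≢ s<N∸r (sym (ℕ.suc-injective e)))))
  ... | no _     | yes refl = inj₂ (cong₂ ℕ._+_ (δ-≢ (λ e → ℕ.<⇒≢ r<N∸s (ℕ.suc-injective e)))
                                                 (δ-≢ (λ e → ℕ.<⇒≢ N∸s<N∸r (sym (ℕ.suc-injective e)))))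
  ... | no U≢s+1 | no U≢N∸s+1 = inj₁ (cong₂ ℕ._+_ (δ-≢ (λ e → U≢s+1 (sym e))) (δ-≢ (λ e → U≢N∸s+1 (sym e))))

  private
    u∸N≤N : ∀ {u} → u ℕ.≤ N ℕ.+ N → u ∸ N ℕ.≤ N
    u∸N≤N {u} u≤2N = ℕ.≤-trans (ℕ.∸-monoˡ-≤ N u≤2N) (ℕ.≤-reflexive (ℕ.m+n∸n≡m N N))

    vanishing-factor : ∀ {a b} x y → a ≡ 0ℤ → b ≡ 0ℤ → x ≡ 0ℤ ⊎ y ≡ 0ℤ → a ≡ b + x * y
    vanishing-factor x y refl refl (inj₁ refl) = sym (ℤ.+-identityˡ (0ℤ * y))
    vanishing-factor x y refl refl (inj₂ refl) = sym (trans (ℤ.+-identityˡ (x * 0ℤ)) (ℤ.*-zeroʳ x))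

  Fr-rotate : ∀ m {u v} → v ≢ 1 → Fr (suc m) (σ u) (σ v) ≡ Fr m u v + Fr m u 1 * from-1 v
  Fr-rotate m {u} {v} v≢1 with layer u
  ... | lower u≤N = vanishing-factor (Fr m u 1) (from-1 v) (Fr-lower (suc m) (σ v) (σ-≤N u≤N)) (Fr-lower m v u≤N) (inj₁ (Fr-lower m 1 u≤N))
  ... | upper 2N<u rewrite σ-beyond (ℕ.<-trans (ℕ.m<m+n N N>0) 2N<u) =
    vanishing-factor (Fr m u 1) (from-1 v) (Fr-upper (suc m) (σ v) 2N<u) (Fr-upper m v 2N<u) (inj₁ (Fr-upper m 1 2N<u))
  ... | frozen N<u u≤2N rewrite σ-beyond N<u with position v
  ...   | at-0       = vanishing-factor (Fr m u 1) (from-1 v) (Fr-to-0 (suc m) u) (Fr-to-0 m u) (inj₂ refl)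
  ...   | at-1       = contradiction refl v≢1
  ...   | beyond N<v rewrite σ-beyond N<v =
    vanishing-factor (Fr m u 1) (from-1 v) (Fr-to-upper (suc m) u N<v) (Fr-to-upper m u N<v) (inj₂ (from-1-beyond N<v))
  ...   | interior w 1≤w w<N rewrite σ-interior 1≤w w<N = begin
    Fr (suc m) u w                                     ≡⟨ Fr-frozen (suc m) N<u u≤2N 1≤w (ℕ.<⇒≤ w<N) ⟩
    F w (+ (suc m ℕ.+ w) - + i)                        ≡⟨ cong (λ n → F w (+ n - + i)) (sym (ℕ.+-suc m w)) ⟩
    F w z                                              ≡⟨ F-recurrence z 1≤w w<N ⟩
    F (suc w) z + from-1 (suc w) * + D (z - + w)       ≡⟨ cong₂ (λ a d → a + from-1 (suc w) * d)
                                                            (sym (Fr-frozen m N<u u≤2N (s≤s z≤n) w<N))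
                                                            (trans (cong (λ y → + D y) z-w≡m+1-i) (sym (Fr-to-1 m N<u u≤2N))) ⟩
    Fr m u (suc w) + from-1 (suc w) * Fr m u 1         ≡⟨ cong (λ p → Fr m u (suc w) + p) (ℤ.*-comm (from-1 (suc w)) (Fr m u 1)) ⟩
    Fr m u (suc w) + Fr m u 1 * from-1 (suc w)         ∎
    where
    open ≡-Reasoning
    i = u ∸ N
    z = + (m ℕ.+ suc w) - + i
    z-w≡m+1-i : z - + w ≡ + (m ℕ.+ 1) - + i
    z-w≡m+1-i = begin
      + (m ℕ.+ suc w) - + i - + w       ≡⟨ cong (λ n → + n - + i - + w) (ℕ.+-suc m w) ⟩
      + (suc m ℕ.+ w) - + i - + w       ≡⟨ cong (λ a → a - + i - + w) (ℤ.pos-+ (suc m) w) ⟩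
      + suc m + + w - + i - + w         ≡⟨ cancel (+ suc m) (+ w) (+ i) ⟩
      + suc m - + i                     ≡⟨ cong (λ n → + n - + i) (ℕ.+-comm 1 m) ⟩
      + (m ℕ.+ 1) - + i                 ∎
      where cancel : ∀ a b c → a + b - c - b ≡ a - c
            cancel = solve-∀

  Fr-last : ∀ m u → Fr (suc m) (σ u) N ≡ - Fr m u 1
  Fr-last m u with layer u
  ... | lower u≤N  rewrite Fr-lower (suc m) N (σ-≤N u≤N) | Fr-lower m 1 u≤N = refl
  ... | upper 2N<u rewrite σ-beyond (ℕ.<-trans (ℕ.m<m+n N N>0) 2N<u) | Fr-upper (suc m) N 2N<u | Fr-upper m 1 2N<u = refl
  ... | frozen N<u u≤2N rewrite σ-beyond N<u = begin
    Fr (suc m) u N                          ≡⟨ Fr-frozen (suc m) N<u u≤2N N>0 ℕ.≤-refl ⟩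
    F N (+ (suc m ℕ.+ N) - + (u ∸ N))       ≡⟨ F-N m (u∸N≤N u≤2N) ⟩
    - F 1 (+ (m ℕ.+ 1) - + (u ∸ N))         ≡⟨ cong -_ (sym (Fr-frozen m N<u u≤2N ℕ.≤-refl N>0)) ⟩
    - Fr m u 1                              ∎
    where open ≡-Reasoning

  -- The exchange matrix of the seed after m mutations, in the labels τ m.
  H : ℕ → ℕ → ℕ → ℤ
  H m u v = G u v + Fr m u v - Fr m v u

  H-skew : ∀ m u v → H m v u ≡ - H m u v
  H-skew m u v = trans (cong (λ g → g + Fr m v u - Fr m u v) (G-skew u v)) (lemma (G u v) (Fr m u v) (Fr m v u))
    where lemma : ∀ g a b → - g + b - a ≡ - (g + a - b)
          lemma = solve-∀

  H-column-1 : ∀ m u → H m u 1 ≡ (to-1 u - from-1 u) + Fr m u 1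
  H-column-1 m u = begin
    G u 1 + Fr m u 1 - Fr m 1 u       ≡⟨ cong₂ (λ g f → g + Fr m u 1 - f) (trans (G-skew 1 u) (cong -_ (G-first-row u))) (Fr-lower m u N>0) ⟩
    - (from-1 u - to-1 u) + Fr m u 1 - 0ℤ ≡⟨ lemma (from-1 u) (to-1 u) (Fr m u 1) ⟩
    (to-1 u - from-1 u) + Fr m u 1    ∎
    where
    open ≡-Reasoning
    lemma : ∀ a b f → - (a - b) + f - 0ℤ ≡ (b - a) + f
    lemma = solve-∀

  H-row-1 : ∀ m v → H m 1 v ≡ (from-1 v - to-1 v) - Fr m v 1
  H-row-1 m v = trans (cong₂ (λ g f → g + f - Fr m v 1) (G-first-row v) (Fr-lower m v N>0))
                      (cong (_- Fr m v 1) (ℤ.+-identityʳ (from-1 v - to-1 v)))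

  private
    arrows-to-1-beyond : ∀ {U} → N ℕ.< U → arrows-to-1 U ≡ 0
    arrows-to-1-beyond {U} N<U = ℤ.+-injective (trans (sym (to-1≡ U)) (to-1-beyond N<U))

    unfrozen-to-1 : ∀ m u → Fr m u 1 ≡ 0ℤ → [ H m u 1 ]₊ ≡ arrows-to-1 u ℕ.+ [ Fr m u 1 ]₊
    unfrozen-to-1 m u Fr≡0 = begin
      [ H m u 1 ]₊                                     ≡⟨ cong [_]₊ (H-column-1 m u) ⟩
      [ (to-1 u - from-1 u) + Fr m u 1 ]₊              ≡⟨ cong [_]₊ (cong₂ (λ a f → a + f) (cong₂ _-_ (to-1≡ u) (from-1≡ u)) Fr≡0) ⟩
      [ (+ arrows-to-1 u - + arrows-from-1 u) + 0ℤ ]₊  ≡⟨ cong [_]₊ (ℤ.+-identityʳ (+ arrows-to-1 u - + arrows-from-1 u)) ⟩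
      [ + arrows-to-1 u - + arrows-from-1 u ]₊         ≡⟨ [+-+]₊-disjoint _ _ (arrows-to-1-or-from-1 u) ⟩
      arrows-to-1 u                                    ≡⟨ sym (ℕ.+-identityʳ _) ⟩
      arrows-to-1 u ℕ.+ [ 0ℤ ]₊                        ≡⟨ cong (λ f → arrows-to-1 u ℕ.+ [ f ]₊) (sym Fr≡0) ⟩
      arrows-to-1 u ℕ.+ [ Fr m u 1 ]₊                  ∎
      where open ≡-Reasoning

    unfrozen-from-1 : ∀ m v → Fr m v 1 ≡ 0ℤ → [ H m 1 v ]₊ ≡ arrows-from-1 v
    unfrozen-from-1 m v Fr≡0 = begin
      [ H m 1 v ]₊                                     ≡⟨ cong [_]₊ (H-row-1 m v) ⟩
      [ (from-1 v - to-1 v) - Fr m v 1 ]₊              ≡⟨ cong [_]₊ (cong₂ _-_ (cong₂ _-_ (from-1≡ v) (to-1≡ v)) Fr≡0) ⟩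
      [ (+ arrows-from-1 v - + arrows-to-1 v) - 0ℤ ]₊  ≡⟨ cong [_]₊ (ℤ.+-identityʳ (+ arrows-from-1 v - + arrows-to-1 v)) ⟩
      [ + arrows-from-1 v - + arrows-to-1 v ]₊         ≡⟨ [+-+]₊-disjoint _ _ (swap (arrows-to-1-or-from-1 v)) ⟩
      arrows-from-1 v                                  ∎
      where open ≡-Reasoning

  [H-to-1]₊ : ∀ m u → [ H m u 1 ]₊ ≡ arrows-to-1 u ℕ.+ [ Fr m u 1 ]₊
  [H-to-1]₊ m u with layer u
  ... | lower u≤N       = unfrozen-to-1 m u (Fr-lower m 1 u≤N)
  ... | upper 2N<u      = unfrozen-to-1 m u (Fr-upper m 1 2N<u)
  ... | frozen N<u u≤2N = begin
    [ H m u 1 ]₊                                  ≡⟨ cong [_]₊ (H-column-1 m u) ⟩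
    [ (to-1 u - from-1 u) + Fr m u 1 ]₊           ≡⟨ cong [_]₊ (cong₂ (λ a b → (a - b) + Fr m u 1) (to-1-beyond N<u) (from-1-beyond N<u)) ⟩
    [ (0ℤ - 0ℤ) + Fr m u 1 ]₊                     ≡⟨ cong [_]₊ (ℤ.+-identityˡ (Fr m u 1)) ⟩
    [ Fr m u 1 ]₊                                 ≡⟨ cong (ℕ._+ [ Fr m u 1 ]₊) (sym (arrows-to-1-beyond N<u)) ⟩
    arrows-to-1 u ℕ.+ [ Fr m u 1 ]₊               ∎
    where open ≡-Reasoning

  [H-from-1]₊ : ∀ m v → [ H m 1 v ]₊ ≡ arrows-from-1 v
  [H-from-1]₊ m v with layer v
  ... | lower v≤N       = unfrozen-from-1 m v (Fr-lower m 1 v≤N)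
  ... | upper 2N<v      = unfrozen-from-1 m v (Fr-upper m 1 2N<v)
  ... | frozen N<v v≤2N = begin
    [ H m 1 v ]₊                                  ≡⟨ cong [_]₊ (H-row-1 m v) ⟩
    [ (from-1 v - to-1 v) - Fr m v 1 ]₊           ≡⟨ cong [_]₊ (cong₂ (λ a b → (a - b) - Fr m v 1) (from-1-beyond N<v) (to-1-beyond N<v)) ⟩
    [ (0ℤ - 0ℤ) - Fr m v 1 ]₊                     ≡⟨ cong [_]₊ (ℤ.+-identityˡ (- Fr m v 1)) ⟩
    [ - Fr m v 1 ]₊                               ≡⟨ cong (λ f → [ - f ]₊) (Fr-to-1-nonneg m v) ⟩
    [ - + [ Fr m v 1 ]₊ ]₊                        ≡⟨ [-+]₊ [ Fr m v 1 ]₊ ⟩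
    0                                             ≡⟨ sym (ℤ.+-injective (trans (sym (from-1≡ v)) (from-1-beyond N<v))) ⟩
    arrows-from-1 v                               ∎
    where open ≡-Reasoning

  H-to-1 : ∀ m u → + [ H m u 1 ]₊ ≡ to-1 u + Fr m u 1
  H-to-1 m u = trans (cong +_ ([H-to-1]₊ m u))
    (trans (ℤ.pos-+ (arrows-to-1 u) [ Fr m u 1 ]₊) (cong₂ _+_ (sym (to-1≡ u)) (sym (Fr-to-1-nonneg m u))))

  H-from-1 : ∀ m v → + [ H m 1 v ]₊ ≡ from-1 v
  H-from-1 m v = trans (cong +_ ([H-from-1]₊ m v)) (sym (from-1≡ v))

  μ₁-H : ∀ m u v → μ 1 (H m) u v ≡ H (suc m) (σ u) (σ v)
  μ₁-H m u v with u ℕ.≟ 1 | v ℕ.≟ 1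
  ... | yes refl | _ = begin
    μ 1 (H m) 1 v                                       ≡⟨ μ-src 1 (H m) v ⟩
    - (G 1 v + Fr m 1 v - Fr m v 1)                     ≡⟨ cong (λ f → - (G 1 v + f - Fr m v 1)) (Fr-lower m v N>0) ⟩
    - (G 1 v + 0ℤ - Fr m v 1)                           ≡⟨ lemma (G 1 v) (Fr m v 1) ⟩
    - G 1 v + 0ℤ - - Fr m v 1                           ≡⟨ sym (sum-difference-cong (G-N-σ v) (Fr-lower (suc m) (σ v) ℕ.≤-refl) (Fr-last m v)) ⟩
    G N (σ v) + Fr (suc m) N (σ v) - Fr (suc m) (σ v) N ∎
    where
    open ≡-Reasoning
    lemma : ∀ g f → - (g + 0ℤ - f) ≡ - g + 0ℤ - - f
    lemma = solve-∀
  ... | no u≢1 | yes refl = begin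
    μ 1 (H m) u 1                                       ≡⟨ μ-tgt 1 (H m) u ⟩
    - (G u 1 + Fr m u 1 - Fr m 1 u)                     ≡⟨ cong₂ (λ g f → - (g + Fr m u 1 - f)) (G-skew 1 u) (Fr-lower m u N>0) ⟩
    - (- G 1 u + Fr m u 1 - 0ℤ)                         ≡⟨ lemma (G 1 u) (Fr m u 1) ⟩
    - - G 1 u + - Fr m u 1 - 0ℤ                         ≡⟨ sym (sum-difference-cong (trans (G-skew N (σ u)) (cong -_ (G-N-σ u))) (Fr-last m u)
                                                                     (Fr-lower (suc m) (σ u) ℕ.≤-refl)) ⟩
    G (σ u) N + Fr (suc m) (σ u) N - Fr (suc m) N (σ u) ∎
    where
    open ≡-Reasoning
    lemma : ∀ g f → - (- g + f - 0ℤ) ≡ - - g + - f - 0ℤ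
    lemma = solve-∀
  ... | no u≢1 | no v≢1 = begin
    μ 1 (H m) u v
      ≡⟨ μ-away 1 (H m) u≢1 v≢1 ⟩
    H m u v + + [ H m u 1 ]₊ * + [ H m 1 v ]₊ - + [ H m v 1 ]₊ * + [ H m 1 u ]₊
      ≡⟨ cong₂ (λ a b → H m u v + a - b) (cong₂ _*_ (H-to-1 m u) (H-from-1 m v)) (cong₂ _*_ (H-to-1 m v) (H-from-1 m u)) ⟩
    (G u v + Fr m u v - Fr m v u) + (to-1 u + Fr m u 1) * from-1 v - (to-1 v + Fr m v 1) * from-1 u
      ≡⟨ regroup (G u v) (Fr m u v) (Fr m v u) (to-1 u) (to-1 v) (from-1 u) (from-1 v) (Fr m u 1) (Fr m v 1) ⟩
    (G u v + (to-1 u * from-1 v - to-1 v * from-1 u)) + (Fr m u v + Fr m u 1 * from-1 v) - (Fr m v u + Fr m v 1 * from-1 u)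
      ≡⟨ sym (sum-difference-cong (G-rotate u≢1 v≢1) (Fr-rotate m {u} v≢1) (Fr-rotate m {v} u≢1)) ⟩
    G (σ u) (σ v) + Fr (suc m) (σ u) (σ v) - Fr (suc m) (σ v) (σ u) ∎
    where
    open ≡-Reasoning
    regroup : ∀ g a b tu tv fu fv xu xv →
      (g + a - b) + (tu + xu) * fv - (tv + xv) * fu ≡ (g + (tu * fv - tv * fu)) + (a + xu * fv) - (b + xv * fu)
    regroup = solve-∀

  Y : ℕ → ℕ → ℕ
  Y = diagonal N 0 N

  GRhat≡[G]₊+Y : ∀ u v → GRhat N r s u v ≡ [ G u v ]₊ ℕ.+ Y u v
  GRhat≡[G]₊+Y u v = cong₂ ℕ._+_ (GR≡[G]₊ u v)
    (family≡diagonal N (λ i → N ℕ.+ i) (λ i → i) N 0 u v (λ _ → refl) (λ _ → refl))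

  Y-src-lower : ∀ {u} v → u ℕ.≤ N → Y u v ≡ 0
  Y-src-lower {u} v u≤N = sum<-zero N _ (λ t _ →
    cong (ℕ._* δ (suc t) v) (δ-> (ℕ.≤-trans (s≤s u≤N) (ℕ.≤-trans (ℕ.m≤m+n (suc N) t) (ℕ.≤-reflexive (sym (ℕ.+-suc N t)))))))

  Y-src-upper : ∀ {u} v → N ℕ.+ N ℕ.< u → Y u v ≡ 0
  Y-src-upper {u} v 2N<u = sum<-zero N _ (λ t t<N →
    cong (ℕ._* δ (suc t) v) (δ-≢ (λ e → ℕ.<⇒≱ 2N<u (subst (ℕ._≤ N ℕ.+ N) e (ℕ.+-monoʳ-≤ N t<N)))))

  Y-tgt-0 : ∀ u → Y u 0 ≡ 0
  Y-tgt-0 u = sum<-zero N _ (λ t _ → ℕ.*-zeroʳ (δ (N ℕ.+ suc t) u))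

  Y-tgt-beyond : ∀ u {v} → N ℕ.< v → Y u v ≡ 0
  Y-tgt-beyond u {v} N<v = sum<-zero N _ (λ t t<N →
    trans (cong (δ (N ℕ.+ suc t) u ℕ.*_) (δ-≢ (λ e → ℕ.<⇒≱ N<v (subst (ℕ._≤ N) e t<N)))) (ℕ.*-zeroʳ (δ (N ℕ.+ suc t) u)))

  Y-frozen : ∀ {u} v → N ℕ.< u → u ℕ.≤ N ℕ.+ N → Y u v ≡ δ v (u ∸ N)
  Y-frozen {u} v N<u u≤2N with u ∸ N | ℕ.m+[n∸m]≡n (ℕ.<⇒≤ N<u) | ℕ.m<n⇒0<n∸m N<u | u∸N≤N u≤2N
  ... | suc t₀ | refl | _ | t₀<N = begin
    ∑[ t < N ] (δ (N ℕ.+ suc t) (N ℕ.+ suc t₀) ℕ.* δ (suc t) v) ≡⟨ sum<-cong N (λ t _ →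
                                                                  cong (ℕ._* δ (suc t) v) (trans (δ-+ N (suc t) (suc t₀)) (δ-sym t t₀))) ⟩
    ∑[ t < N ] (δ t₀ t ℕ.* δ (suc t) v)                          ≡⟨ sum<-δ N t₀ (λ t → δ (suc t) v) t₀<N ⟩
    δ (suc t₀) v                                                ≡⟨ δ-sym (suc t₀) v ⟩
    δ v (suc t₀)                                                ∎
    where open ≡-Reasoning

  private
    Fr-0-frozen : ∀ {u v} → N ℕ.< u → u ℕ.≤ N ℕ.+ N → 1 ℕ.≤ v → v ℕ.≤ N → Fr 0 u v ≡ + Y u v
    Fr-0-frozen {u} {v} N<u u≤2N 1≤v v≤N = trans (Fr-frozen 0 N<u u≤2N 1≤v v≤N)
      (trans (F-initial (ℕ.m<n⇒0<n∸m N<u) v≤N) (sym (cong +_ (Y-frozen v N<u u≤2N))))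

  Fr-0 : ∀ u v → Fr 0 u v ≡ + Y u v
  Fr-0 u v with layer u
  ... | lower u≤N  = trans (Fr-lower 0 v u≤N) (sym (cong +_ (Y-src-lower v u≤N)))
  ... | upper 2N<u = trans (Fr-upper 0 v 2N<u) (sym (cong +_ (Y-src-upper v 2N<u)))
  ... | frozen N<u u≤2N with position v
  ...   | at-0               = trans (Fr-to-0 0 u) (sym (cong +_ (Y-tgt-0 u)))
  ...   | at-1               = Fr-0-frozen N<u u≤2N ℕ.≤-refl N>0
  ...   | interior w 1≤w w<N = Fr-0-frozen N<u u≤2N (s≤s z≤n) w<N
  ...   | beyond N<v         = trans (Fr-to-upper 0 u N<v) (sym (cong +_ (Y-tgt-beyond u N<v)))

  private
    initial-from : ∀ u v {g a b} → G u v ≡ g → Y u v ≡ a → Y v u ≡ b → [ g ]₊ ℕ.+ a ≡ [ g + + a - + b ]₊ →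
                   GRhat N r s u v ≡ [ H 0 u v ]₊
    initial-from u v refl refl refl eq = trans (GRhat≡[G]₊+Y u v)
      (trans eq (cong [_]₊ (sym (cong₂ (λ p q → G u v + p - q) (Fr-0 u v) (Fr-0 v u)))))

    no-frozen-arrows : ∀ g → [ g ]₊ ℕ.+ 0 ≡ [ g + 0ℤ - 0ℤ ]₊
    no-frozen-arrows g = trans (ℕ.+-identityʳ [ g ]₊) (cong [_]₊ (sym (trans (ℤ.+-identityʳ (g + 0ℤ)) (ℤ.+-identityʳ g))))

  initial-matrix : ∀ u v → GRhat N r s u v ≡ [ H 0 u v ]₊
  initial-matrix u v with layer u
  ... | frozen N<u u≤2N =
    initial-from u v (G-outside (src-beyond N<u)) refl (Y-tgt-beyond v N<u) (cong [_]₊ (sym (ℤ.+-identityʳ (+ Y u v))))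
  ... | upper 2N<u =
    initial-from u v (G-outside (src-beyond N<u)) (Y-src-upper v 2N<u) (Y-tgt-beyond v N<u) refl
    where N<u = ℕ.<-trans (ℕ.m<m+n N N>0) 2N<u
  ... | lower u≤N with layer v
  ...   | frozen N<v _ = initial-from u v (G-outside (tgt-beyond N<v)) (Y-src-lower v u≤N) refl
                                    (sym (trans (cong [_]₊ (ℤ.+-identityˡ (- + Y v u))) ([-+]₊ (Y v u))))
  ...   | lower v≤N    = initial-from u v refl (Y-src-lower v u≤N) (Y-src-lower u v≤N) (no-frozen-arrows (G u v))
  ...   | upper 2N<v   = initial-from u v refl (Y-src-lower v u≤N) (Y-src-upper u 2N<v) (no-frozen-arrows (G u v))

module ExchangeRelation {c ℓ} (SF : Semifield c ℓ) {N r s : ℕ} (adm : Admissible N r s)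
                        (x y : ℕ → Semifield.Carrier SF) where

  open import Data.Nat as ℕ using (zero; suc; _∸_; z≤n; s≤s; _≤?_; >-nonZero)
  import Data.Nat.Properties as ℕ
  open import Data.Integer using (+_; _+_; _-_)
  import Data.Integer.Properties as ℤ
  open import Data.Integer.Tactic.RingSolver using (solve-∀)
  open import Data.Product using (_×_; _,_; proj₁; proj₂)
  open import Relation.Nullary using (yes; no; contradiction)
  open import Relation.Nullary.Decidable using (dec-true; dec-false)
  import Relation.Binary.PropositionalEquality as ≡
  open import Relation.Binary.PropositionalEquality using (_≡_; _≢_; cong)
  open import Algebra.Structures using (IsCommutativeSemigroup)
  open Semifield SF
  open GaleRobinson SF N r s x y
  module ⊕ = IsCommutativeSemigroup +-isCommutativeSemigroup
  open Products SF
  open Counting using (δ; eqb-≢; eqb-refl)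
  open IntegerFacts using ([_]₊)
  open Arithmetic adm using (N>0; r<N; s<N; r≤N; s≤N; N∸r<N; N∸s<N)
  open RepresentationCount r (N ∸ r) {{>-nonZero (Arithmetic.r>0 adm)}} {{>-nonZero (ℕ.m<n⇒0<n∸m r<N)}} using (D)
  open FrozenEntries adm using (Fr; layer; lower; frozen; upper; Fr-lower; Fr-to-1)
  open Periodicity adm
  open Rotation N {{>-nonZero N>0}}
  open MatrixMutation using (mutQuiver-cong; mutQuiver-relabel; mutQuiver-[]₊; μ)

  Q : ℕ → Quiver
  Q m = proj₁ (seed m)

  X : ℕ → Vars
  X m = proj₂ (seed m)

  Q-invariant : ∀ m u v → Q m u v ≡ [ H m (τ m u) (τ m v) ]₊
  Q-invariant zero    u v = initial-matrix u v
  Q-invariant (suc m) u v = begin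
    mutQuiver (κ m) (Q m) u v                                       ≡⟨ mutQuiver-cong (κ m) (Q-invariant m) u v ⟩
    mutQuiver (κ m) (λ a b → [ H m (τ m a) (τ m b) ]₊) u v          ≡⟨ mutQuiver-relabel (τ m) (τ-eqb m) (κ m) (λ a b → [ H m a b ]₊) u v ⟩
    mutQuiver (τ m (κ m)) (λ a b → [ H m a b ]₊) (τ m u) (τ m v)    ≡⟨ cong (λ k → mutQuiver k (λ a b → [ H m a b ]₊) (τ m u) (τ m v)) (τ-κ m) ⟩
    mutQuiver 1 (λ a b → [ H m a b ]₊) (τ m u) (τ m v)              ≡⟨ mutQuiver-[]₊ (H m) (H-skew m) 1 (τ m u) (τ m v) ⟩
    [ μ 1 (H m) (τ m u) (τ m v) ]₊                                  ≡⟨ cong [_]₊ (μ₁-H m (τ m u) (τ m v)) ⟩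
    [ H (suc m) (τ (suc m) u) (τ (suc m) v) ]₊                      ∎
    where open ≡.≡-Reasoning

  X-frozen : ∀ m {i} → 1 ℕ.≤ i → X m (N ℕ.+ i) ≡ y i
  X-frozen zero    {i} 1≤i rewrite dec-false (N ℕ.+ i ≤? N) (ℕ.<⇒≱ (ℕ.m<m+n N 1≤i)) | ℕ.m+n∸m≡n N i = ≡.refl
  X-frozen (suc m) {i} 1≤i
    rewrite eqb-≢ {N ℕ.+ i} {κ m} (λ e → ℕ.<⇒≱ (ℕ.m<m+n N 1≤i) (ℕ.≤-trans (ℕ.≤-reflexive e) (proj₂ (κ-range m)))) =
    X-frozen m 1≤i

  xs-new : ∀ m → xs (suc m ℕ.+ N) ≡ X (suc m) (κ m)
  xs-new m rewrite dec-false (suc m ℕ.+ N ≤? N) (ℕ.<⇒≱ (s≤s (ℕ.m≤n+m N m))) | ℕ.m+n∸n≡m (suc m) N = ≡.refl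

  X-mutable : ∀ m {v} → 1 ℕ.≤ v → v ℕ.≤ N → X m v ≈ xs (m ℕ.+ τ m v)
  X-mutable zero    {v} _   v≤N rewrite dec-true (v ≤? N) v≤N = refl
  X-mutable (suc m) {v} 1≤v v≤N with v ℕ.≟ κ m
  ... | yes ≡.refl = ≡⇒≈ (≡.sym (≡.trans (cong (λ c → xs (suc m ℕ.+ σ c)) (τ-κ m)) (xs-new m)))
  ... | no  v≢κ rewrite eqb-≢ v≢κ =
    trans (X-mutable m 1≤v v≤N) (≡⇒≈ (cong xs (relabel (τ m v) (τ-range m 1≤v v≤N) (λ e → v≢κ (τ-injective m (≡.trans e (≡.sym (τ-κ m))))))))
    where
    relabel : ∀ t → 1 ℕ.≤ t × t ℕ.≤ N → t ≢ 1 → m ℕ.+ t ≡ suc m ℕ.+ σ t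
    relabel (suc zero)    _           t≢1 = contradiction ≡.refl t≢1
    relabel (suc (suc w)) (_ , 2+w≤N) _   = ≡.trans (ℕ.+-suc m (suc w)) (cong (λ t → suc m ℕ.+ t) (≡.sym (σ-interior (s≤s z≤n) 2+w≤N)))

  Fr-τ-to-1 : ∀ m u → Fr m (τ m u) 1 ≡ Fr m u 1
  Fr-τ-to-1 m u with layer u
  ... | lower u≤N      = ≡.trans (Fr-lower m 1 (τ-≤N m u≤N)) (≡.sym (Fr-lower m 1 u≤N))
  ... | frozen N<u _   = cong (λ t → Fr m t 1) (τ-beyond m N<u)
  ... | upper 2N<u     = cong (λ t → Fr m t 1) (τ-beyond m (ℕ.<-trans (ℕ.m<m+n N N>0) 2N<u))

  exponent-to-κ : ∀ m u → Q m u (κ m) ≡ arrows-to-1 (τ m u) ℕ.+ [ Fr m u 1 ]₊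
  exponent-to-κ m u = begin
    Q m u (κ m)                                  ≡⟨ Q-invariant m u (κ m) ⟩
    [ H m (τ m u) (τ m (κ m)) ]₊                 ≡⟨ cong (λ k → [ H m (τ m u) k ]₊) (τ-κ m) ⟩
    [ H m (τ m u) 1 ]₊                           ≡⟨ [H-to-1]₊ m (τ m u) ⟩
    arrows-to-1 (τ m u) ℕ.+ [ Fr m (τ m u) 1 ]₊  ≡⟨ cong (λ f → arrows-to-1 (τ m u) ℕ.+ [ f ]₊) (Fr-τ-to-1 m u) ⟩
    arrows-to-1 (τ m u) ℕ.+ [ Fr m u 1 ]₊        ∎
    where open ≡.≡-Reasoning

  exponent-from-κ : ∀ m w → Q m (κ m) w ≡ arrows-from-1 (τ m w)
  exponent-from-κ m w =
    ≡.trans (Q-invariant m (κ m) w) (≡.trans (cong (λ k → [ H m k (τ m w) ]₊) (τ-κ m)) ([H-from-1]₊ m (τ m w)))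

  private
    product-δ-τ : ∀ m {c} → 1 ℕ.≤ c → c ℕ.≤ N → prod1 (N ℕ.+ N) (λ u → X m u ^ δ c (τ m u)) ≈ xs (m ℕ.+ c)
    product-δ-τ m {c} 1≤c c≤N with τ-surjective m 1≤c c≤N
    ... | w , (1≤w , w≤N) , τw≡c = begin
      prodFrom 1 (N ℕ.+ N) (λ u → X m u ^ δ c (τ m u))
        ≈⟨ prodFrom-cong 1 (N ℕ.+ N) (λ u _ _ → ≡⇒≈ (cong (X m u ^_)
             (≡.trans (cong (λ t → δ t (τ m u)) (≡.sym τw≡c)) (cong ind (τ-eqb m w u))))) ⟩
      prodFrom 1 (N ℕ.+ N) (λ u → X m u ^ δ w u)   ≈⟨ prodFrom-δ 1 (N ℕ.+ N) (X m) 1≤w (s≤s (ℕ.≤-trans w≤N (ℕ.m≤m+n N N))) ⟩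
      X m w                                        ≈⟨ X-mutable m 1≤w w≤N ⟩
      xs (m ℕ.+ τ m w)                             ≈⟨ ≡⇒≈ (cong (λ t → xs (m ℕ.+ t)) τw≡c) ⟩
      xs (m ℕ.+ c)                                 ∎
      where open import Relation.Binary.Reasoning.Setoid setoid

  coefficient : ℕ → Carrier
  coefficient m = prod1 N (λ i → y i ^ D (+ (m ℕ.+ 1) - + i))

  product-frozen : ∀ m → prod1 (N ℕ.+ N) (λ u → X m u ^ [ Fr m u 1 ]₊) ≈ coefficient m
  product-frozen m = begin
    prodFrom 1 (N ℕ.+ N) f                  ≈⟨ prodFrom-+ 1 N N f ⟩
    prodFrom 1 N f ⊗ prodFrom (1 ℕ.+ N) N f
      ≈⟨ ∙-cong (prodFrom-1 1 N f (λ u _ u<1+N → ≡⇒≈ (cong (λ e → X m u ^ [ e ]₊) (Fr-lower m 1 (ℕ.≤-pred u<1+N)))))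
                (≡⇒≈ (≡.trans (cong (λ l → prodFrom l N f) (ℕ.+-comm 1 N)) (prodFrom-shift N 1 N f))) ⟩
    1# ⊗ prodFrom 1 N (λ i → f (N ℕ.+ i))    ≈⟨ identityˡ _ ⟩
    prodFrom 1 N (λ i → f (N ℕ.+ i))
      ≈⟨ prodFrom-cong 1 N (λ i 1≤i i<1+N → ≡⇒≈ (≡.cong₂ _^_ (X-frozen m 1≤i) (cong [_]₊
           (≡.trans (Fr-to-1 m (ℕ.m<m+n N 1≤i) (ℕ.+-monoʳ-≤ N (ℕ.≤-pred i<1+N)))
                    (cong (λ t → + D (+ (m ℕ.+ 1) - + t)) (ℕ.m+n∸m≡n N i)))))) ⟩
    coefficient m                           ∎
    where
    open import Relation.Binary.Reasoning.Setoid setoid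
    f : ℕ → Carrier
    f u = X m u ^ [ Fr m u 1 ]₊

  product-to-κ : ∀ m → prod1 (N ℕ.+ N) (λ u → X m u ^ Q m u (κ m))
                       ≈ (xs (m ℕ.+ suc s) ⊗ xs (m ℕ.+ suc (N ∸ s))) ⊗ coefficient m
  product-to-κ m = begin
    prodFrom 1 (N ℕ.+ N) (λ u → X m u ^ Q m u (κ m))
      ≈⟨ prodFrom-cong 1 (N ℕ.+ N) (λ u _ _ → trans (≡⇒≈ (cong (X m u ^_) (exponent-to-κ m u)))
           (trans (^-+ (X m u) (arrows-to-1 (τ m u)) _) (∙-cong (^-+ (X m u) (δ (suc s) (τ m u)) _) refl))) ⟩
    prodFrom 1 (N ℕ.+ N) (λ u → (A u ⊗ B u) ⊗ C u)
      ≈⟨ trans (prodFrom-⊗ 1 (N ℕ.+ N) (λ u → A u ⊗ B u) C) (∙-cong (prodFrom-⊗ 1 (N ℕ.+ N) A B) refl) ⟩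
    (prod1 (N ℕ.+ N) A ⊗ prod1 (N ℕ.+ N) B) ⊗ prod1 (N ℕ.+ N) C
      ≈⟨ ∙-cong (∙-cong (product-δ-τ m (s≤s z≤n) s<N) (product-δ-τ m (s≤s z≤n) N∸s<N)) (product-frozen m) ⟩
    (xs (m ℕ.+ suc s) ⊗ xs (m ℕ.+ suc (N ∸ s))) ⊗ coefficient m ∎
    where
    open import Relation.Binary.Reasoning.Setoid setoid
    A B C : ℕ → Carrier
    A u = X m u ^ δ (suc s) (τ m u)
    B u = X m u ^ δ (suc (N ∸ s)) (τ m u)
    C u = X m u ^ [ Fr m u 1 ]₊

  product-from-κ : ∀ m → prod1 (N ℕ.+ N) (λ w → X m w ^ Q m (κ m) w) ≈ xs (m ℕ.+ suc r) ⊗ xs (m ℕ.+ suc (N ∸ r))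
  product-from-κ m = begin
    prodFrom 1 (N ℕ.+ N) (λ w → X m w ^ Q m (κ m) w)
      ≈⟨ prodFrom-cong 1 (N ℕ.+ N) (λ w _ _ → trans (≡⇒≈ (cong (X m w ^_) (exponent-from-κ m w)))
           (^-+ (X m w) (δ (suc r) (τ m w)) _)) ⟩
    prodFrom 1 (N ℕ.+ N) (λ w → A w ⊗ B w)        ≈⟨ prodFrom-⊗ 1 (N ℕ.+ N) A B ⟩
    prod1 (N ℕ.+ N) A ⊗ prod1 (N ℕ.+ N) B         ≈⟨ ∙-cong (product-δ-τ m (s≤s z≤n) r<N) (product-δ-τ m (s≤s z≤n) N∸r<N) ⟩
    xs (m ℕ.+ suc r) ⊗ xs (m ℕ.+ suc (N ∸ r))     ∎
    where
    open import Relation.Binary.Reasoning.Setoid setoid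
    A B : ℕ → Carrier
    A w = X m w ^ δ (suc r) (τ m w)
    B w = X m w ^ δ (suc (N ∸ r)) (τ m w)

  exchange : ∀ m → xs (suc m ℕ.+ N) ⊗ xs (suc m)
                   ≈ xs (m ℕ.+ suc (N ∸ r)) ⊗ xs (m ℕ.+ suc r) ⊕ coefficient m ⊗ (xs (m ℕ.+ suc (N ∸ s)) ⊗ xs (m ℕ.+ suc s))
  exchange m = begin
    xs (suc m ℕ.+ N) ⊗ xs (suc m)                     ≈⟨ ∙-cong (≡⇒≈ (≡.trans (xs-new m) new-variable)) refl ⟩
    (into ⊕ out) ⊗ X m (κ m) ⁻¹ ⊗ xs (suc m)          ≈⟨ cancel-⁻¹ (into ⊕ out) (X m (κ m)) (xs (suc m)) old-variable ⟩
    into ⊕ out                                        ≈⟨ ⊕.comm into out ⟩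
    out ⊕ into                                        ≈⟨ ⊕.∙-cong (trans (product-from-κ m) (comm _ _))
                                                                  (trans (product-to-κ m) (trans (comm _ _) (∙-cong refl (comm _ _)))) ⟩
    xs (m ℕ.+ suc (N ∸ r)) ⊗ xs (m ℕ.+ suc r) ⊕ coefficient m ⊗ (xs (m ℕ.+ suc (N ∸ s)) ⊗ xs (m ℕ.+ suc s)) ∎
    where
    open import Relation.Binary.Reasoning.Setoid setoid
    into out : Carrier
    into = prod1 (N ℕ.+ N) (λ u → X m u ^ Q m u (κ m))
    out  = prod1 (N ℕ.+ N) (λ w → X m w ^ Q m (κ m) w)
    new-variable : X (suc m) (κ m) ≡ (into ⊕ out) ⊗ X m (κ m) ⁻¹
    new-variable rewrite eqb-refl (κ m) = ≡.refl
    old-variable : X m (κ m) ≈ xs (suc m)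
    old-variable = trans (X-mutable m (proj₁ (κ-range m)) (proj₂ (κ-range m)))
                         (≡⇒≈ (cong xs (≡.trans (cong (m ℕ.+_) (τ-κ m)) (ℕ.+-comm m 1))))

  private
    1+m+N∸t : ∀ m {t} → t ℕ.≤ N → suc m ℕ.+ N ∸ t ≡ m ℕ.+ suc (N ∸ t)
    1+m+N∸t m t≤N = ≡.trans (ℕ.+-∸-assoc (suc m) t≤N) (≡.sym (ℕ.+-suc m _))

    1+m+N∸N+t : ∀ m t → suc m ℕ.+ N ∸ N ℕ.+ t ≡ m ℕ.+ suc t
    1+m+N∸N+t m t = ≡.trans (cong (ℕ._+ t) (ℕ.m+n∸n≡m (suc m) N)) (≡.sym (ℕ.+-suc m t))

    1+m+N-N-i : ∀ m i → + (suc m ℕ.+ N) - + N - + i ≡ + (m ℕ.+ 1) - + i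
    1+m+N-N-i m i = begin
      + (suc m ℕ.+ N) - + N - + i     ≡⟨ cong (λ k → + (k ℕ.+ N) - + N - + i) (ℕ.+-comm 1 m) ⟩
      + (m ℕ.+ 1 ℕ.+ N) - + N - + i   ≡⟨ cong (λ z → z - + N - + i) (ℤ.pos-+ (m ℕ.+ 1) N) ⟩
      + (m ℕ.+ 1) + + N - + N - + i   ≡⟨ cancel (+ (m ℕ.+ 1)) (+ N) (+ i) ⟩
      + (m ℕ.+ 1) - + i               ∎
      where
      open ≡.≡-Reasoning
      cancel : ∀ a b c → a + b - b - c ≡ a - c
      cancel = solve-∀

  exchange-relation : ∀ n → N ℕ.+ 1 ℕ.≤ n →
    xs n ⊗ xs (n ∸ N)
    ≈ xs (n ∸ r) ⊗ xs (n ∸ N ℕ.+ r)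
      ⊕ prod1 N (λ i → y i ^ d (+ n - + N - + i) r (N ∸ r)) ⊗ (xs (n ∸ s) ⊗ xs (n ∸ N ℕ.+ s))
  exchange-relation n N+1≤n with n ∸ suc N | 1+[n∸1+N]+N≡n
    where
    1+[n∸1+N]+N≡n : suc (n ∸ suc N) ℕ.+ N ≡ n
    1+[n∸1+N]+N≡n = ≡.trans (≡.sym (ℕ.+-suc (n ∸ suc N) N)) (ℕ.m∸n+n≡m (≡.subst (ℕ._≤ n) (ℕ.+-comm N 1) N+1≤n))
  ... | m | ≡.refl = begin
    xs (suc m ℕ.+ N) ⊗ xs (suc m ℕ.+ N ∸ N)
      ≈⟨ ∙-cong refl (≡⇒≈ (cong xs (ℕ.m+n∸n≡m (suc m) N))) ⟩
    xs (suc m ℕ.+ N) ⊗ xs (suc m)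
      ≈⟨ exchange m ⟩
    xs (m ℕ.+ suc (N ∸ r)) ⊗ xs (m ℕ.+ suc r) ⊕ coefficient m ⊗ (xs (m ℕ.+ suc (N ∸ s)) ⊗ xs (m ℕ.+ suc s))
      ≈⟨ sym (⊕.∙-cong (∙-cong (at (1+m+N∸t m r≤N)) (at (1+m+N∸N+t m r)))
                       (∙-cong (prodFrom-cong 1 N (λ i _ _ → ≡⇒≈ (cong (λ z → y i ^ D z) (1+m+N-N-i m i))))
                               (∙-cong (at (1+m+N∸t m s≤N)) (at (1+m+N∸N+t m s))))) ⟩
    xs (suc m ℕ.+ N ∸ r) ⊗ xs (suc m ℕ.+ N ∸ N ℕ.+ r)
      ⊕ prod1 N (λ i → y i ^ d (+ (suc m ℕ.+ N) - + N - + i) r (N ∸ r)) ⊗ (xs (suc m ℕ.+ N ∸ s) ⊗ xs (suc m ℕ.+ N ∸ N ℕ.+ s)) ∎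
    where
    open import Relation.Binary.Reasoning.Setoid setoid
    at : ∀ {i j} → i ≡ j → xs i ≈ xs j
    at i≡j = ≡⇒≈ (cong xs i≡j)

open import Data.Nat using (_+_; _*_; _∸_; _<_; _≤_)
open import Data.Integer using (+_; _-_)

proposition4p8 : ∀ {c ℓ} (F : Semifield c ℓ) (N r s : ℕ) →
    0 < r → r < s → 2 * s ≤ N →
    (x y : ℕ → Semifield.Carrier F) →
    ∀ n → N + 1 ≤ n →
    let open Semifield F
        open GaleRobinson F N r s x y
    in xs n ⊗ xs (n ∸ N)
       ≈ xs (n ∸ r) ⊗ xs (n ∸ N + r)
         ⊕ prod1 N (λ i → y i ^ d (+ n - + N - + i) r (N ∸ r)) ⊗ (xs (n ∸ s) ⊗ xs (n ∸ N + s))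
proposition4p8 F N r s r>0 r<s 2s≤N x y =
  ExchangeRelation.exchange-relation F (record { r>0 = r>0 ; r<s = r<s ; 2s≤N = 2s≤N }) x y
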